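{- Let $(\hat G,z)$ be a $\mathbb{Z}$-labelled graph with vertex set $\{1,\dots,n\}$, and let $\mathcal F(\hat G,z)=(F_e)_{e\in\hat E^\circ}$, a family of matrices in $\mathcal L^{n+1}$. Then: (i) $\mathcal F(\hat G,z)$ is linearly independent if and only if $\hat G$ has no selfloop, the multiplicity between any two vertices is at most two, and the multiplicity graph of $\hat G$ is a forest; (ii) $\mathcal F(\hat G,z)$ spans $\mathcal L^{n+1}$ if and only if $\mathrm{si}(\hat G)=K_n$ (the simple complete graph) and the multiplicity graph of $\hat G$ is spanning.
   Context: A $\mathbb{Z}$-labelled graph $(\hat G,z)$ is a finite directed multigraph $\hat G=(\hat V,\hat E)$ (selfloops allowed) with a map $z:\hat E\to\mathbb{Z}$, assumed simple (selfloops have nonzero labels; no two parallel edges have the same direction and label, nor opposite directions and opposite labels); an edge from $i$ to $j$ with label $\gamma$ is written $(i,j;\gamma)$. Set $\hat E^\circ=\hat E\cup\{e_L\}$ with $e_L$ an additional edge symbol. For $e=(i,j;z(e))\in\hat E$ let $i_e=\begin{pmatrix}\mathbf e_j-\mathbf e_i\\ z(e)\end{pmatrix}\in\mathbb{R}^{n+1}$ ($\mathbf e_i$ the $i$-th unit vector of $\mathbb{R}^n$), let $i_{e_L}$ be the $(n+1)$-st unit vector of $\mathbb{R}^{n+1}$, and $F_e=i_ei_e^\top$. Let $\mathbf 1'_{n+1}=(1,\dots,1,0)^\top\in\mathbb{R}^{n+1}$ and $\mathcal L^{n+1}=\{A\in\mathcal S^{n+1}:A\mathbf 1'_{n+1}=0\}$,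 where $\mathcal S^{n+1}$ is the space of real symmetric $(n+1)\times(n+1)$ matrices. The multiplicity between two distinct vertices $i,j$ is the number of edges of $\hat G$ between $i$ and $j$ ignoring directions. The multiplicity graph of $\hat G$ is the simple undirected graph on $\hat V$ in which distinct $i,j$ are adjacent iff their multiplicity is at least $2$; it is called spanning if it is connected on all of $\hat V$ (i.e., contains a spanning tree). $\mathrm{si}(\hat G)$ is the simple loopless undirected graph obtained from $\hat G$ by removing selfloops and forgetting directions and multiplicities.
   Formalization: Linear independence and spanning are taken over ℚ: the coefficients are rational and the matrices in $\mathcal L^{n+1}$ have rational entries rather than real ones. -}

module Defs where

open import Data.Nat as ℕ using (ℕ; zero; suc; _≤_)
open import Data.Integer as ℤ using (ℤ)
open import Data.Rational as ℚ using (ℚ; 0ℚ; 1ℚ; _+_; _*_; _-_)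
open import Data.Fin as Fin using (Fin; zero; suc; inject₁; fromℕ)
open import Data.Fin.Properties using () renaming (_≟_ to _≟ᶠ_)
open import Data.Maybe using (Maybe; just; nothing)
import Data.Maybe as Maybe
open import Data.Bool using (Bool; true; false; if_then_else_; _∧_; _∨_)
open import Data.Product using (Σ; ∃; _×_; _,_)
open import Data.Sum using (_⊎_)
open import Relation.Nullary using (¬_)
open import Relation.Nullary.Decidable using (⌊_⌋)
open import Relation.Binary.PropositionalEquality using (_≡_; _≢_)
open import Function.Definitions using (Injective)

-- Z-labelled graphs on vertex set Fin n (vertices 1..n ↦ 0..n-1),
-- with m edges indexed by Fin m (a multigraph: distinct indices are
-- distinct edges).

record Edge (n : ℕ) : Set where
  constructor edge
  field
    src : Fin n
    tgt : Fin n
    lab : ℤ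
open Edge public

IsSimpleLabelled : ∀ {n m} → (Fin m → Edge n) → Set
IsSimpleLabelled {n} {m} E =
  (∀ a → src (E a) ≡ tgt (E a) → lab (E a) ≢ ℤ.0ℤ)
  × (∀ a b → a ≢ b → E a ≢ E b)
  × (∀ a b → a ≢ b →
       ¬ (src (E a) ≡ tgt (E b) × tgt (E a) ≡ src (E b)
          × lab (E a) ≡ ℤ.- lab (E b)))

∑ : ∀ {k} → (Fin k → ℚ) → ℚ
∑ {zero}  f = 0ℚ
∑ {suc k} f = f zero + ∑ (λ t → f (suc t))

countℕ : ∀ {k} → (Fin k → Bool) → ℕ
countℕ {zero}  f = 0
countℕ {suc k} f = (if f zero then 1 else 0) ℕ.+ countℕ (λ t → f (suc t))

-- Vectors/matrices of size n+1: index (inject₁ v) for vertex v, the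
-- last index (fromℕ n) is the extra (n+1)-st coordinate.

toVert : ∀ {n} → Fin (suc n) → Maybe (Fin n)
toVert {zero}  zero    = nothing
toVert {suc n} zero    = just zero
toVert {suc n} (suc k) = Maybe.map suc (toVert k)

RVec : ℕ → Set
RVec n = Fin (suc n) → ℚ

Mat : ℕ → Set
Mat n = Fin (suc n) → Fin (suc n) → ℚ

δ : ∀ {n} → Fin n → Fin n → ℚ
δ a b = if ⌊ a ≟ᶠ b ⌋ then 1ℚ else 0ℚ

iVec : ∀ {n} → Edge n → RVec n
iVec e k with toVert k
... | nothing = lab e ℚ./ 1
... | just v  = δ (tgt e) v - δ (src e) v

iL : ∀ {n} → RVec n
iL k with toVert k
... | nothing = 1ℚ
... | just _  = 0ℚ

outer : ∀ {n} → RVec n → Mat n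
outer x r s = x r * x s

-- The index set Ê° = Ê ∪ {e_L}: zero ↦ e_L, suc a ↦ edge a.
iFam : ∀ {n m} → (Fin m → Edge n) → Fin (suc m) → RVec n
iFam E zero    = iL
iFam E (suc a) = iVec (E a)

𝓕 : ∀ {n m} → (Fin m → Edge n) → Fin (suc m) → Mat n
𝓕 E e = outer (iFam E e)

lincomb : ∀ {n k} → (Fin k → Mat n) → (Fin k → ℚ) → Mat n
lincomb F c r s = ∑ (λ a → c a * F a r s)

LinearlyIndependent : ∀ {n k} → (Fin k → Mat n) → Set
LinearlyIndependent F =
  ∀ c → (∀ r s → lincomb F c r s ≡ 0ℚ) → ∀ a → c a ≡ 0ℚ

one′ : ∀ {n} → RVec n
one′ k with toVert k
... | nothing = 0ℚ
... | just _  = 1ℚ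

In𝓛 : ∀ {n} → Mat n → Set
In𝓛 A = (∀ r s → A r s ≡ A s r) × (∀ r → ∑ (λ s → A r s * one′ s) ≡ 0ℚ)

Spans𝓛 : ∀ {n k} → (Fin k → Mat n) → Set
Spans𝓛 {n} F = ∀ (A : Mat n) → In𝓛 A → ∃ λ c → ∀ r s → lincomb F c r s ≡ A r s

joins : ∀ {n} → Edge n → Fin n → Fin n → Bool
joins e i j =
  (⌊ src e ≟ᶠ i ⌋ ∧ ⌊ tgt e ≟ᶠ j ⌋) ∨ (⌊ src e ≟ᶠ j ⌋ ∧ ⌊ tgt e ≟ᶠ i ⌋)

multiplicity : ∀ {n m} → (Fin m → Edge n) → Fin n → Fin n → ℕ
multiplicity E i j = countℕ (λ a → joins (E a) i j)

NoSelfloop : ∀ {n m} → (Fin m → Edge n) → Set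
NoSelfloop E = ∀ a → src (E a) ≢ tgt (E a)

MultAtMostTwo : ∀ {n m} → (Fin m → Edge n) → Set
MultAtMostTwo E = ∀ i j → i ≢ j → multiplicity E i j ≤ 2

MultAdj : ∀ {n m} → (Fin m → Edge n) → Fin n → Fin n → Set
MultAdj E i j = i ≢ j × 2 ≤ multiplicity E i j

HasCycle : ∀ {n} → (Fin n → Fin n → Set) → Set
HasCycle {n} adj =
  Σ ℕ λ k → Σ (Fin (suc (suc (suc k))) → Fin n) λ p →
    Injective _≡_ _≡_ p
    × (∀ (t : Fin (suc (suc k))) → adj (p (inject₁ t)) (p (suc t)))
    × adj (p (fromℕ (suc (suc k)))) (p zero)

IsForest : ∀ {n} → (Fin n → Fin n → Set) → Set
IsForest adj = ¬ HasCycle adj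

data Reach {n} (adj : Fin n → Fin n → Set) : Fin n → Fin n → Set where
  here : ∀ {i} → Reach adj i i
  step : ∀ {i j k} → adj i j → Reach adj j k → Reach adj i k

IsSpanning : ∀ {n} → (Fin n → Fin n → Set) → Set
IsSpanning {n} adj = ∀ (i j : Fin n) → Reach adj i j

siAdj : ∀ {n m} → (Fin m → Edge n) → Fin n → Fin n → Set
siAdj E i j = i ≢ j × ∃ λ a → joins (E a) i j ≡ true

KAdj : ∀ {n} → Fin n → Fin n → Set
KAdj i j = i ≢ j

SiIsComplete : ∀ {n m} → (Fin m → Edge n) → Set
SiIsComplete E = ∀ i j → (siAdj E i j → KAdj i j) × (KAdj i j → siAdj E i j)

{-# OPTIONS --safe #-}
-- Write matrices of 𝓛^{n+1} in block form [[T, v], [vᵀ, x]]. Then F_{e_L} = [[0, 0], [0, 1]] and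
-- F_e = [[d dᵀ, z(e) d], [z(e) dᵀ, z(e)²]] with d = e_j − e_i for e = (i, j; z(e)); a selfloop has d = 0,
-- so F_e = z(e)² F_{e_L}.
--
-- Let ∑ c_e F_e have T = 0. The entry T_ij forces c_e = 0 when e is the only edge between i and j, so
-- the flow ν_ij = ∑ ±c_e z(e) over the edges between i and j lives on the multiplicity graph; its
-- divergence is v. On a forest a divergence-free flow vanishes, and then T_ij = ν_ij = 0 kill the
-- coefficients of a double edge, whose oriented labels ±z(e) differ by simplicity: independence. If the
-- multiplicity graph is disconnected, no flow has divergence e_j − e_i across the cut: no spanning.
--
-- Conversely, two parallel edges combine with F_{e_L} to [[0, e_j − e_i], [·, 0]]. Around a cycle of the
-- multiplicity graph, or twice for three parallel edges, this gives a dependence; along paths it gives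
-- every [[0, v], [vᵀ, 0]] with ∑ v = 0. With an edge between i and j it gives [[d dᵀ, 0], [0, 0]], and
-- these span every symmetric T with zero row sums.

module Submission where

open import Defs
open import Data.Nat as ℕ using (ℕ; zero; suc; _≤_; _≤?_; s≤s; z≤n)
import Data.Nat.Properties as ℕP
import Data.Bool.Properties as BoolP
import Data.Nat.GCD as ℕGCD
import Data.Integer as ℤ
import Data.Integer.Properties as ℤP
open import Data.Rational as ℚ using (ℚ; 0ℚ; 1ℚ; _+_; _*_; _-_; -_; ↥_; 1/_)
import Data.Rational.Properties as ℚP
open import Data.Rational.Solver using (module +-*-Solver)
open import Algebra.Properties.Group ℚP.+-0-group using (inverseʳ-unique)
open import Data.Fin as Fin using (Fin; zero; suc; inject₁; fromℕ)
open import Data.Fin.Properties using () renaming (_≟_ to _≟ᶠ_)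
import Data.Fin.Properties as FinP
open import Data.Maybe using (Maybe; just; nothing; maybe)
open import Data.Bool using (Bool; true; false; if_then_else_; not; _∧_)
open import Data.Product using (Σ; ∃; _×_; _,_; proj₁; proj₂)
open import Data.Sum using (_⊎_; inj₁; inj₂)
open import Data.Empty using (⊥; ⊥-elim)
open import Function using (_∘_)
open import Function.Bundles using (_⇔_; mk⇔; module Equivalence)
open import Function.Definitions using (Injective)
open import Relation.Nullary using (¬_; Dec; yes; no; does)
open import Relation.Nullary.Decidable using (⌊_⌋; map′; ¬?; _×-dec_; _⊎-dec_; decidable-stable; isYes≗does; dec-true)
open import Relation.Binary.PropositionalEquality
open ≡-Reasoning
open +-*-Solver using (solve; _:+_; _:*_; :-_; _:-_; _:=_; con)

↥[i/1]≡i : ∀ i → ↥ (i ℚ./ 1) ≡ i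
↥[i/1]≡i i = begin
  ↥ (i ℚ./ 1)
    ≡⟨ sym (ℤP.*-identityʳ _) ⟩
  ↥ (i ℚ./ 1) ℤ.* ℤ.+ 1
    ≡⟨ cong (λ g → ↥ (i ℚ./ 1) ℤ.* ℤ.+ g) (sym (ℕGCD.gcd-zeroʳ ℤ.∣ i ∣)) ⟩
  ↥ (i ℚ./ 1) ℤ.* ℤ.+ ℕGCD.gcd ℤ.∣ i ∣ 1
    ≡⟨ ℚP.↥-/ i 1 ⟩
  i ∎

/1-injective : ∀ {i j} → i ℚ./ 1 ≡ j ℚ./ 1 → i ≡ j
/1-injective {i} {j} eq = trans (sym (↥[i/1]≡i i)) (trans (cong ↥_ eq) (↥[i/1]≡i j))

/1-neg : ∀ {i j} → i ℚ./ 1 ≡ - (j ℚ./ 1) → i ≡ ℤ.- j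
/1-neg {i} {j} eq =
  trans (sym (↥[i/1]≡i i)) (trans (cong ↥_ eq) (trans (ℚP.↥-neg (j ℚ./ 1)) (cong ℤ.-_ (↥[i/1]≡i j))))

p≢q⇒p-q≢0 : ∀ {p q} → p ≢ q → p - q ≢ 0ℚ
p≢q⇒p-q≢0 {p} {q} p≢q p-q≡0 = p≢q (begin
  p             ≡⟨ solve 2 (λ p q → p := (p :- q) :+ q) refl p q ⟩
  (p - q) + q   ≡⟨ cong (_+ q) p-q≡0 ⟩
  0ℚ + q        ≡⟨ ℚP.+-identityˡ q ⟩
  q             ∎)

p*q≡0⇒p≡0 : ∀ {p q} → q ≢ 0ℚ → p * q ≡ 0ℚ → p ≡ 0ℚ
p*q≡0⇒p≡0 {p} {q} q≢0 pq≡0 = begin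
  p                ≡⟨ sym (ℚP.*-identityʳ p) ⟩
  p * 1ℚ           ≡⟨ cong (p *_) (sym (ℚP.*-inverseʳ q)) ⟩
  p * (q * q⁻¹)    ≡⟨ sym (ℚP.*-assoc p q q⁻¹) ⟩
  (p * q) * q⁻¹    ≡⟨ cong (_* q⁻¹) pq≡0 ⟩
  0ℚ * q⁻¹         ≡⟨ ℚP.*-zeroˡ q⁻¹ ⟩
  0ℚ               ∎
  where instance _ = ℚ.≢-nonZero q≢0
        q⁻¹ = 1/ q

x≡-x⇒x≡0 : ∀ {x} → x ≡ - x → x ≡ 0ℚ
x≡-x⇒x≡0 {x} x≡-x = begin
  x                   ≡⟨ solve 1 (λ x → x := (x :+ x) :* con ℚ.½) refl x ⟩
  (x + x) * ℚ.½       ≡⟨ cong (λ y → (x + y) * ℚ.½) x≡-x ⟩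
  (x + - x) * ℚ.½     ≡⟨ cong (_* ℚ.½) (ℚP.+-inverseʳ x) ⟩
  0ℚ * ℚ.½            ≡⟨ ℚP.*-zeroˡ ℚ.½ ⟩
  0ℚ                  ∎

∑-cong : ∀ {k} {f g : Fin k → ℚ} → (∀ i → f i ≡ g i) → ∑ f ≡ ∑ g
∑-cong {zero}  f≗g = refl
∑-cong {suc k} f≗g = cong₂ _+_ (f≗g zero) (∑-cong (f≗g ∘ suc))

∑-zero : ∀ {k} {f : Fin k → ℚ} → (∀ i → f i ≡ 0ℚ) → ∑ f ≡ 0ℚ
∑-zero {zero}  f≗0 = refl
∑-zero {suc k} f≗0 = cong₂ _+_ (f≗0 zero) (∑-zero (f≗0 ∘ suc))

∑-distrib-+ : ∀ {k} (f g : Fin k → ℚ) → ∑ (λ i → f i + g i) ≡ ∑ f + ∑ g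
∑-distrib-+ {zero}  f g = refl
∑-distrib-+ {suc k} f g = begin
  (f zero + g zero) + ∑ (λ i → f (suc i) + g (suc i))
    ≡⟨ cong ((f zero + g zero) +_) (∑-distrib-+ (f ∘ suc) (g ∘ suc)) ⟩
  (f zero + g zero) + (∑ (f ∘ suc) + ∑ (g ∘ suc))
    ≡⟨ solve 4 (λ a b c d → (a :+ b) :+ (c :+ d) := (a :+ c) :+ (b :+ d)) refl (f zero) (g zero) _ _ ⟩
  (f zero + ∑ (f ∘ suc)) + (g zero + ∑ (g ∘ suc)) ∎

∑-*ˡ : ∀ {k} (c : ℚ) (f : Fin k → ℚ) → ∑ (λ i → c * f i) ≡ c * ∑ f
∑-*ˡ {zero}  c f = sym (ℚP.*-zeroʳ c)
∑-*ˡ {suc k} c f = trans (cong (c * f zero +_) (∑-*ˡ c (f ∘ suc))) (sym (ℚP.*-distribˡ-+ c _ _))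

∑-*ʳ : ∀ {k} (c : ℚ) (f : Fin k → ℚ) → ∑ (λ i → f i * c) ≡ ∑ f * c
∑-*ʳ c f = trans (∑-cong (λ i → ℚP.*-comm (f i) c)) (trans (∑-*ˡ c f) (ℚP.*-comm c _))

∑-neg : ∀ {k} (f : Fin k → ℚ) → ∑ (λ i → - f i) ≡ - ∑ f
∑-neg {zero}  f = refl
∑-neg {suc k} f = trans (cong (- f zero +_) (∑-neg (f ∘ suc))) (sym (ℚP.neg-distrib-+ (f zero) _))

∑-distrib-- : ∀ {k} (f g : Fin k → ℚ) → ∑ (λ i → f i - g i) ≡ ∑ f - ∑ g
∑-distrib-- f g = trans (∑-distrib-+ f (λ i → - g i)) (cong (∑ f +_) (∑-neg g))

∑-comm : ∀ {k l} (f : Fin k → Fin l → ℚ) → ∑ (λ i → ∑ (f i)) ≡ ∑ (λ j → ∑ (λ i → f i j))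
∑-comm {zero} {l} f = sym (∑-zero {l} (λ j → refl))
∑-comm {suc k} f = begin
  ∑ (f zero) + ∑ (λ i → ∑ (f (suc i)))           ≡⟨ cong (∑ (f zero) +_) (∑-comm (f ∘ suc)) ⟩
  ∑ (f zero) + ∑ (λ j → ∑ (λ i → f (suc i) j))   ≡⟨ sym (∑-distrib-+ (f zero) _) ⟩
  ∑ (λ j → f zero j + ∑ (λ i → f (suc i) j))     ∎

∑-single : ∀ {k} {f : Fin k → ℚ} (a : Fin k) → (∀ i → i ≢ a → f i ≡ 0ℚ) → ∑ f ≡ f a
∑-single {suc k} {f} zero    f≗0 =
  trans (cong (f zero +_) (∑-zero (λ i → f≗0 (suc i) λ ()))) (ℚP.+-identityʳ _)
∑-single {suc k} {f} (suc a) f≗0 =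
  trans (cong₂ _+_ (f≗0 zero λ ()) (∑-single a (λ i i≢a → f≗0 (suc i) (i≢a ∘ FinP.suc-injective))))
        (ℚP.+-identityˡ _)

∑∑-single : ∀ {k l} {f : Fin k → Fin l → ℚ} (a : Fin k) (b : Fin l) →
  (∀ i j → i ≢ a → f i j ≡ 0ℚ) → (∀ j → j ≢ b → f a j ≡ 0ℚ) → ∑ (λ i → ∑ (f i)) ≡ f a b
∑∑-single a b rows≗0 row≗0 =
  trans (∑-single a (λ i i≢a → ∑-zero (λ j → rows≗0 i j i≢a))) (∑-single b row≗0)

∑-pair : ∀ {k} {f : Fin k → ℚ} (a b : Fin k) → a ≢ b →
  (∀ i → i ≢ a → i ≢ b → f i ≡ 0ℚ) → ∑ f ≡ f a + f b
∑-pair {suc k} {f} zero    zero    a≢b f≗0 = ⊥-elim (a≢b refl)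
∑-pair {suc k} {f} zero    (suc b) a≢b f≗0 =
  cong (f zero +_) (∑-single b (λ i i≢b → f≗0 (suc i) (λ ()) (i≢b ∘ FinP.suc-injective)))
∑-pair {suc k} {f} (suc a) zero    a≢b f≗0 =
  trans (cong (f zero +_) (∑-single a (λ i i≢a → f≗0 (suc i) (i≢a ∘ FinP.suc-injective) (λ ()))))
        (ℚP.+-comm (f zero) _)
∑-pair {suc k} {f} (suc a) (suc b) a≢b f≗0 = begin
  f zero + ∑ (f ∘ suc)    ≡⟨ cong₂ _+_ (f≗0 zero (λ ()) (λ ())) (∑-pair a b (a≢b ∘ cong suc) tail≗0) ⟩
  0ℚ + (f (suc a) + f (suc b)) ≡⟨ ℚP.+-identityˡ _ ⟩
  f (suc a) + f (suc b)  ∎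
  where
  tail≗0 : ∀ i → i ≢ a → i ≢ b → f (suc i) ≡ 0ℚ
  tail≗0 i i≢a i≢b = f≗0 (suc i) (i≢a ∘ FinP.suc-injective) (i≢b ∘ FinP.suc-injective)

∑-last : ∀ {n} (f : Fin (suc n) → ℚ) → ∑ f ≡ ∑ (f ∘ inject₁) + f (fromℕ n)
∑-last {zero}  f = trans (ℚP.+-identityʳ (f zero)) (sym (ℚP.+-identityˡ (f zero)))
∑-last {suc n} f =
  trans (cong (f zero +_) (∑-last (f ∘ suc))) (sym (ℚP.+-assoc (f zero) _ (f (suc (fromℕ n)))))

∑-telescope : ∀ {k} (x : Fin (suc k) → ℚ) → ∑ (λ t → x (suc t) - x (inject₁ t)) ≡ x (fromℕ k) - x zero
∑-telescope {zero}  x = sym (ℚP.+-inverseʳ (x zero))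
∑-telescope {suc k} x = begin
  (x (suc zero) - x zero) + ∑ (λ t → x (suc (suc t)) - x (suc (inject₁ t)))
    ≡⟨ cong ((x (suc zero) - x zero) +_) (∑-telescope (x ∘ suc)) ⟩
  (x (suc zero) - x zero) + (x (suc (fromℕ k)) - x (suc zero))
    ≡⟨ solve 3 (λ a b c → (a :- b) :+ (c :- a) := c :- b) refl (x (suc zero)) (x zero) (x (suc (fromℕ k))) ⟩
  x (suc (fromℕ k)) - x zero ∎

δ-refl : ∀ {k} (a : Fin k) → δ a a ≡ 1ℚ
δ-refl a with a ≟ᶠ a
... | yes _   = refl
... | no a≢a  = ⊥-elim (a≢a refl)

δ-≢ : ∀ {k} {a b : Fin k} → a ≢ b → δ a b ≡ 0ℚ
δ-≢ {a = a} {b} a≢b with a ≟ᶠ b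
... | yes a≡b = ⊥-elim (a≢b a≡b)
... | no _    = refl

δ-sym : ∀ {k} (a b : Fin k) → δ a b ≡ δ b a
δ-sym a b with a ≟ᶠ b | b ≟ᶠ a
... | yes _   | yes _   = refl
... | no _    | no _    = refl
... | yes a≡b | no b≢a  = ⊥-elim (b≢a (sym a≡b))
... | no a≢b  | yes b≡a = ⊥-elim (a≢b (sym b≡a))

δ*δ-off : ∀ {k} {a b i j : Fin k} → ¬ (a ≡ i × b ≡ j) → δ a i * δ b j ≡ 0ℚ
δ*δ-off {a = a} {b} {i} {j} off with a ≟ᶠ i | b ≟ᶠ j
... | yes a≡i | yes b≡j = ⊥-elim (off (a≡i , b≡j))
... | yes _   | no _    = refl
... | no _    | yes _   = refl
... | no _    | no _    = refl

∑-δˡ : ∀ {k} (a : Fin k) (f : Fin k → ℚ) → ∑ (λ b → δ a b * f b) ≡ f a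
∑-δˡ a f = trans (∑-single a (λ b b≢a → trans (cong (_* f b) (δ-≢ (b≢a ∘ sym))) (ℚP.*-zeroˡ (f b))))
                 (trans (cong (_* f a) (δ-refl a)) (ℚP.*-identityˡ (f a)))

∑-δʳ : ∀ {k} (a : Fin k) (f : Fin k → ℚ) → ∑ (λ b → f b * δ b a) ≡ f a
∑-δʳ a f = trans (∑-cong (λ b → trans (ℚP.*-comm (f b) _) (cong (_* f b) (δ-sym b a)))) (∑-δˡ a f)

∑-δ : ∀ {k} (a : Fin k) → ∑ (δ a) ≡ 1ℚ
∑-δ a = trans (∑-cong (λ b → sym (ℚP.*-identityʳ (δ a b)))) (∑-δˡ a (λ _ → 1ℚ))

countℕ-cong : ∀ {k} {f g : Fin k → Bool} → (∀ x → f x ≡ g x) → countℕ f ≡ countℕ g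
countℕ-cong {zero}  f≗g = refl
countℕ-cong {suc k} f≗g = cong₂ ℕ._+_ (cong (λ b → if b then 1 else 0) (f≗g zero)) (countℕ-cong (f≗g ∘ suc))

countℕ-remove : ∀ {k} {f g : Fin k → Bool} (a : Fin k) → (∀ x → x ≢ a → f x ≡ g x) →
  f a ≡ true → g a ≡ false → countℕ f ≡ suc (countℕ g)
countℕ-remove {suc k} {f} {g} zero f≗g fa ga rewrite fa | ga = cong suc (countℕ-cong (λ x → f≗g (suc x) λ ()))
countℕ-remove {suc k} {f} {g} (suc a) f≗g fa ga rewrite f≗g zero (λ ()) with g zero
... | true  = cong suc (countℕ-remove a (λ x x≢a → f≗g (suc x) (x≢a ∘ FinP.suc-injective)) fa ga)
... | false = countℕ-remove a (λ x x≢a → f≗g (suc x) (x≢a ∘ FinP.suc-injective)) fa ga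

_without_ : ∀ {k} → (Fin k → Bool) → Fin k → Fin k → Bool
(f without a) x = f x ∧ not ⌊ x ≟ᶠ a ⌋

without-≢ : ∀ {k} (f : Fin k → Bool) {a x : Fin k} → x ≢ a → (f without a) x ≡ f x
without-≢ f {a} {x} x≢a with x ≟ᶠ a | f x
... | yes x≡a | _     = ⊥-elim (x≢a x≡a)
... | no _    | true  = refl
... | no _    | false = refl

without-self : ∀ {k} (f : Fin k → Bool) (a : Fin k) → (f without a) a ≡ false
without-self f a with a ≟ᶠ a | f a
... | yes _   | true  = refl
... | yes _   | false = refl
... | no a≢a  | _     = ⊥-elim (a≢a refl)

without-true : ∀ {k} (f : Fin k → Bool) {a x : Fin k} → (f without a) x ≡ true → f x ≡ true × x ≢ a
without-true f {a} {x} h with x ≟ᶠ a | f x | h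
... | no x≢a | true  | _  = refl , x≢a
... | yes _  | true  | ()
... | _      | false | ()

countℕ-without : ∀ {k} (f : Fin k → Bool) {a : Fin k} → f a ≡ true → countℕ f ≡ suc (countℕ (f without a))
countℕ-without f {a} fa = countℕ-remove a (λ x x≢a → sym (without-≢ f x≢a)) fa (without-self f a)

countℕ-pos : ∀ {k} (f : Fin k → Bool) {a : Fin k} → f a ≡ true → 1 ≤ countℕ f
countℕ-pos f fa rewrite countℕ-without f fa = s≤s z≤n

countℕ-witness : ∀ {k} (f : Fin k → Bool) → 1 ≤ countℕ f → ∃ λ a → f a ≡ true
countℕ-witness {suc k} f h with f zero in fzero
... | true  = zero , fzero
... | false = let a , fa = countℕ-witness (f ∘ suc) h in suc a , fa

countℕ-two-witnesses : ∀ {k} (f : Fin k → Bool) → 2 ≤ countℕ f →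
  ∃ λ a → ∃ λ b → a ≢ b × f a ≡ true × f b ≡ true
countℕ-two-witnesses f h with countℕ-witness f (ℕP.≤-trans (s≤s z≤n) h)
... | a , fa with countℕ-witness (f without a) (ℕP.≤-pred (subst (2 ≤_) (countℕ-without f fa) h))
... | b , f'b = let fb , b≢a = without-true f f'b in a , b , b≢a ∘ sym , fa , fb

countℕ-three-witnesses : ∀ {k} (f : Fin k → Bool) → 3 ≤ countℕ f →
  ∃ λ a → ∃ λ b → ∃ λ c → a ≢ b × a ≢ c × b ≢ c × f a ≡ true × f b ≡ true × f c ≡ true
countℕ-three-witnesses f h with countℕ-witness f (ℕP.≤-trans (s≤s z≤n) h)
... | a , fa with countℕ-two-witnesses (f without a) (ℕP.≤-pred (subst (3 ≤_) (countℕ-without f fa) h))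
... | b , c , b≢c , f'b , f'c =
  let fb , b≢a = without-true f f'b ; fc , c≢a = without-true f f'c in
  a , b , c , b≢a ∘ sym , c≢a ∘ sym , b≢c , fa , fb , fc

countℕ≤1-unique : ∀ {k} (f : Fin k → Bool) → countℕ f ≤ 1 →
  ∀ {a x} → f a ≡ true → f x ≡ true → x ≡ a
countℕ≤1-unique f h {a} {x} fa fx with x ≟ᶠ a
... | yes x≡a = x≡a
... | no x≢a  = ⊥-elim (ℕP.<-irrefl refl (ℕP.≤-trans (s≤s another) (subst (_≤ 1) (countℕ-without f fa) h)))
  where another = countℕ-pos (f without a) (trans (without-≢ f x≢a) fx)

countℕ≤2-unique : ∀ {k} (f : Fin k → Bool) → countℕ f ≤ 2 →
  ∀ {a b x} → a ≢ b → f a ≡ true → f b ≡ true → f x ≡ true → x ≡ a ⊎ x ≡ b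
countℕ≤2-unique f h {a} {b} {x} a≢b fa fb fx with x ≟ᶠ a | x ≟ᶠ b
... | yes x≡a | _       = inj₁ x≡a
... | no _    | yes x≡b = inj₂ x≡b
... | no x≢a  | no x≢b  = ⊥-elim (ℕP.<-irrefl refl (ℕP.≤-trans (s≤s (s≤s another)) (subst (_≤ 2) count≡ h)))
  where
  f' = (f without a) without b
  another = countℕ-pos f' (trans (without-≢ (f without a) x≢b) (trans (without-≢ f x≢a) fx))
  count≡ : countℕ f ≡ suc (suc (countℕ f'))
  count≡ = trans (countℕ-without f fa) (cong suc (countℕ-without (f without a) (trans (without-≢ f (a≢b ∘ sym)) fb)))

module Reachability {n : ℕ} (adj : Fin n → Fin n → Set) (adj? : ∀ i j → Dec (adj i j)) where

  length : ∀ {i j} → Reach adj i j → ℕ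
  length here       = 0
  length (step _ p) = suc (length p)

  vertex : ∀ {i j} (p : Reach adj i j) → Fin (suc (length p)) → Fin n
  vertex {i} here       zero    = i
  vertex {i} (step _ p) zero    = i
  vertex     (step _ p) (suc t) = vertex p t

  Simple : ∀ {i j} → Reach adj i j → Set
  Simple p = Injective _≡_ _≡_ (vertex p)

  vertex-first : ∀ {i j} (p : Reach adj i j) → vertex p zero ≡ i
  vertex-first here       = refl
  vertex-first (step _ p) = refl

  vertex-last : ∀ {i j} (p : Reach adj i j) → vertex p (fromℕ (length p)) ≡ j
  vertex-last here       = refl
  vertex-last (step _ p) = vertex-last p

  vertex-adj : ∀ {i j} (p : Reach adj i j) (t : Fin (length p)) → adj (vertex p (inject₁ t)) (vertex p (suc t))
  vertex-adj {i} (step a p) zero    = subst (adj i) (sym (vertex-first p)) a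
  vertex-adj     (step a p) (suc t) = vertex-adj p t

  suffix : ∀ {i k} (p : Reach adj i k) → Simple p → (t : Fin (suc (length p))) → Σ (Reach adj (vertex p t) k) Simple
  suffix here       simple zero    = here , simple
  suffix (step a p) simple zero    = step a p , simple
  suffix (step a p) simple (suc t) = suffix p (FinP.suc-injective ∘ simple) t

  simplify : ∀ {i k} → Reach adj i k → Σ (Reach adj i k) Simple
  simplify here = here , λ { {zero} {zero} _ → refl }
  simplify {i} {k} (step a p) with simplify p
  ... | q , simple with FinP.any? (λ t → vertex q t ≟ᶠ i)
  ...   | yes (t , qt≡i) = subst (λ x → Σ (Reach adj x k) Simple) qt≡i (suffix q simple t)
  ...   | no i∉q         = step a q , injective
    where
    injective : Simple (step a q)
    injective {zero}  {zero}  _  = refl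
    injective {zero}  {suc y} eq = ⊥-elim (i∉q (y , sym eq))
    injective {suc x} {zero}  eq = ⊥-elim (i∉q (x , eq))
    injective {suc x} {suc y} eq = cong suc (simple eq)

  simple-length< : ∀ {i j} (p : Reach adj i j) → Simple p → length p ℕ.< n
  simple-length< p simple with suc (length p) ℕP.≤? n
  ... | yes h = h
  ... | no h with FinP.pigeonhole (ℕP.≰⇒> h) (vertex p)
  ...   | x , y , x<y , same = ⊥-elim (ℕP.<-irrefl (cong Fin.toℕ (simple same)) x<y)

  data Reach≤ : ℕ → Fin n → Fin n → Set where
    here : ∀ {k i} → Reach≤ k i i
    step : ∀ {k i j l} → adj i j → Reach≤ k j l → Reach≤ (suc k) i l

  reach≤? : ∀ k i j → Dec (Reach≤ k i j)
  reach≤? k i j with i ≟ᶠ j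
  reach≤? k       i .i | yes refl = yes here
  reach≤? zero    i j  | no i≢j   = no λ { here → i≢j refl }
  reach≤? (suc k) i j  | no i≢j with FinP.any? (λ l → adj? i l ×-dec reach≤? k l j)
  ... | yes (l , a , r) = yes (step a r)
  ... | no none         = no λ { here → i≢j refl ; (step a r) → none (_ , a , r) }

  Reach≤⇒Reach : ∀ {k i j} → Reach≤ k i j → Reach adj i j
  Reach≤⇒Reach here       = here
  Reach≤⇒Reach (step a r) = step a (Reach≤⇒Reach r)

  Reach⇒Reach≤ : ∀ {k i j} (p : Reach adj i j) → length p ≤ k → Reach≤ k i j
  Reach⇒Reach≤ here       _       = here
  Reach⇒Reach≤ (step a p) (s≤s h) = step a (Reach⇒Reach≤ p h)

  reach? : ∀ i j → Dec (Reach adj i j)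
  reach? i j with reach≤? n i j
  ... | yes r = yes (Reach≤⇒Reach r)
  ... | no ¬r = no λ p → let q , simple = simplify p in
                  ¬r (Reach⇒Reach≤ q (ℕP.<⇒≤ (simple-length< q simple)))

  reach-snoc : ∀ {i j k} → Reach adj i j → adj j k → Reach adj i k
  reach-snoc here       a = step a here
  reach-snoc (step b p) a = step b (reach-snoc p a)

  reached : Fin n → Fin n → ℚ
  reached i k with reach? i k
  ... | yes _ = 1ℚ
  ... | no _  = 0ℚ

  reached-yes : ∀ {i k} → Reach adj i k → reached i k ≡ 1ℚ
  reached-yes {i} {k} r with reach? i k
  ... | yes _ = refl
  ... | no ¬r = ⊥-elim (¬r r)

  reached-no : ∀ {i k} → ¬ Reach adj i k → reached i k ≡ 0ℚ
  reached-no {i} {k} ¬r with reach? i k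
  ... | yes r = ⊥-elim (¬r r)
  ... | no _  = refl

  crossing-zero : ∀ {i j k x} → (Reach adj i k → ¬ Reach adj i j → x ≡ 0ℚ) →
    (reached i k * (1ℚ - reached i j)) * x ≡ 0ℚ
  crossing-zero {i} {j} {k} {x} h = by-cases (reach? i k) (reach? i j)
    where
    by-cases : Dec (Reach adj i k) → Dec (Reach adj i j) → (reached i k * (1ℚ - reached i j)) * x ≡ 0ℚ
    by-cases (no ¬rk) _ = begin
      (reached i k * (1ℚ - reached i j)) * x
        ≡⟨ cong (λ a → (a * (1ℚ - reached i j)) * x) (reached-no ¬rk) ⟩
      (0ℚ * (1ℚ - reached i j)) * x
        ≡⟨ solve 2 (λ b x → (con 0ℚ :* (con 1ℚ :- b)) :* x := con 0ℚ) refl (reached i j) x ⟩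
      0ℚ ∎
    by-cases (yes _) (yes rj) = begin
      (reached i k * (1ℚ - reached i j)) * x
        ≡⟨ cong (λ b → (reached i k * (1ℚ - b)) * x) (reached-yes rj) ⟩
      (reached i k * (1ℚ - 1ℚ)) * x
        ≡⟨ solve 2 (λ a x → (a :* (con 1ℚ :- con 1ℚ)) :* x := con 0ℚ) refl (reached i k) x ⟩
      0ℚ ∎
    by-cases (yes rk) (no ¬rj) = trans (cong (w *_) (h rk ¬rj)) (ℚP.*-zeroʳ w)
      where w = reached i k * (1ℚ - reached i j)

∑∑-antisym : ∀ {n} (g : Fin n → Fin n → ℚ) → (∀ i j → g i j ≡ - g j i) → ∑ (λ i → ∑ (g i)) ≡ 0ℚ
∑∑-antisym g anti = x≡-x⇒x≡0 (begin
  ∑ (λ i → ∑ (g i))              ≡⟨ ∑-comm g ⟩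
  ∑ (λ j → ∑ (λ i → g i j))      ≡⟨ ∑-cong (λ j → ∑-cong (λ i → anti i j)) ⟩
  ∑ (λ j → ∑ (λ i → - g j i))    ≡⟨ ∑-cong (λ j → ∑-neg (g j)) ⟩
  ∑ (λ j → - ∑ (g j))            ≡⟨ ∑-neg (λ j → ∑ (g j)) ⟩
  - ∑ (λ j → ∑ (g j))            ∎)

flux : ∀ {n} (χ : Fin n → ℚ) (ν : Fin n → Fin n → ℚ) → (∀ i j → ν i j ≡ - ν j i) →
  ∑ (λ k → χ k * ∑ (λ j → ν j k)) ≡ ∑ (λ k → ∑ (λ j → (χ k * (1ℚ - χ j)) * ν j k))
flux {n} χ ν anti = begin
  ∑ (λ k → χ k * ∑ (λ j → ν j k))
    ≡⟨ ∑-cong (λ k → sym (∑-*ˡ (χ k) (λ j → ν j k))) ⟩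
  ∑ (λ k → ∑ (λ j → χ k * ν j k))
    ≡⟨ ∑-cong (λ k → ∑-cong (λ j → split k j)) ⟩
  ∑ (λ k → ∑ (λ j → inside k j + crossing k j))
    ≡⟨ ∑-cong (λ k → ∑-distrib-+ (inside k) (crossing k)) ⟩
  ∑ (λ k → ∑ (inside k) + ∑ (crossing k))
    ≡⟨ ∑-distrib-+ (λ k → ∑ (inside k)) (λ k → ∑ (crossing k)) ⟩
  ∑ (λ k → ∑ (inside k)) + ∑ (λ k → ∑ (crossing k))
    ≡⟨ cong (_+ ∑ (λ k → ∑ (crossing k))) (∑∑-antisym inside inside-antisym) ⟩
  0ℚ + ∑ (λ k → ∑ (crossing k))
    ≡⟨ ℚP.+-identityˡ _ ⟩
  ∑ (λ k → ∑ (crossing k)) ∎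
  where
  inside crossing : Fin n → Fin n → ℚ
  inside   k j = (χ k * χ j) * ν j k
  crossing k j = (χ k * (1ℚ - χ j)) * ν j k
  split : ∀ k j → χ k * ν j k ≡ inside k j + crossing k j
  split k j = solve 3 (λ a b x → a :* x := (a :* b) :* x :+ (a :* (con 1ℚ :- b)) :* x) refl (χ k) (χ j) (ν j k)
  inside-antisym : ∀ k j → inside k j ≡ - inside j k
  inside-antisym k j = trans (cong ((χ k * χ j) *_) (anti j k))
    (solve 3 (λ a b x → (a :* b) :* (:- x) := :- ((b :* a) :* x)) refl (χ k) (χ j) (ν k j))

-- If ν u v ≢ 0, let S be the set reached from v along the support of ν without the edge uv.
-- Since the support is a forest, u ∉ S, so ν u v is the only flow across the boundary of S,
-- while by `flux` the net inflow into S is 0.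
circulation-on-forest : ∀ {n} {R : Fin n → Fin n → Set} → IsForest R →
  (ν : Fin n → Fin n → ℚ) → (∀ i j → ν i j ≡ - ν j i) → (∀ k → ∑ (λ j → ν j k) ≡ 0ℚ) →
  (∀ i j → ν i j ≢ 0ℚ → R i j) → ∀ u v → ν u v ≡ 0ℚ
circulation-on-forest {n} {R} forest ν antisym divergence-free support u v with ν u v ℚP.≟ 0ℚ
... | yes ν[u,v]≡0 = ν[u,v]≡0
... | no  ν[u,v]≢0 = begin
  ν u v
    ≡⟨ sym (ℚP.*-identityˡ (ν u v)) ⟩
  (1ℚ * (1ℚ - 0ℚ)) * ν u v
    ≡⟨ cong₂ (λ a b → (a * (1ℚ - b)) * ν u v) (sym (reached-yes {v} here)) (sym (reached-no {v} {u} u-unreached)) ⟩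
  crossing v u
    ≡⟨ sym (∑∑-single v u (λ k j k≢v → crossing-off (k≢v ∘ proj₁)) (λ j j≢u → crossing-off (j≢u ∘ proj₂))) ⟩
  ∑ (λ k → ∑ (crossing k))
    ≡⟨ sym (flux (reached v) ν antisym) ⟩
  ∑ (λ k → reached v k * ∑ (λ j → ν j k))
    ≡⟨ ∑-zero (λ k → trans (cong (reached v k *_) (divergence-free k)) (ℚP.*-zeroʳ (reached v k))) ⟩
  0ℚ ∎
  where
  u≢v : u ≢ v
  u≢v refl = ν[u,v]≢0 (x≡-x⇒x≡0 (antisym u u))

  IsUV : Fin n → Fin n → Set
  IsUV i j = (i ≡ u × j ≡ v) ⊎ (i ≡ v × j ≡ u)

  OtherEdge : Fin n → Fin n → Set
  OtherEdge i j = ν i j ≢ 0ℚ × ¬ IsUV i j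

  open Reachability OtherEdge
    (λ i j → ¬? (ν i j ℚP.≟ 0ℚ) ×-dec ¬? ((i ≟ᶠ u ×-dec j ≟ᶠ v) ⊎-dec (i ≟ᶠ v ×-dec j ≟ᶠ u)))

  u-unreached : ¬ Reach OtherEdge v u
  u-unreached p with simplify p
  ... | here , _                        = u≢v refl
  ... | step (_ , notUV) here , _       = notUV (inj₂ (refl , refl))
  ... | q@(step _ (step _ q′)) , simple =
    forest (length q′ , vertex q , simple ,
            (λ t → support _ _ (proj₁ (vertex-adj q t))) ,
            subst (λ w → R w v) (sym (vertex-last q)) (support u v ν[u,v]≢0))

  crossing : Fin n → Fin n → ℚ
  crossing k j = (reached v k * (1ℚ - reached v j)) * ν j k

  crossing-off : ∀ {k j} → ¬ (k ≡ v × j ≡ u) → crossing k j ≡ 0ℚ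
  crossing-off {k} {j} not-vu = crossing-zero λ rk ¬rj → decidable-stable (ν j k ℚP.≟ 0ℚ) λ ν[j,k]≢0 →
    ¬rj (reach-snoc rk ((λ ν[k,j]≡0 → ν[j,k]≢0 (trans (antisym j k) (cong -_ ν[k,j]≡0))) , other-edge ¬rj))
    where
    other-edge : ¬ Reach OtherEdge v j → ¬ IsUV k j
    other-edge ¬rj (inj₁ (_ , j≡v)) = ¬rj (subst (Reach OtherEdge v) (sym j≡v) here)
    other-edge _   (inj₂ k≡v×j≡u)   = not-vu k≡v×j≡u

combination : ∀ {k} {X : Set} → (Fin k → X → ℚ) → (Fin k → ℚ) → X → ℚ
combination G c x = ∑ (λ a → c a * G a x)

record Represents {k} {X : Set} (G : Fin k → X → ℚ) (c : Fin k → ℚ) (B : X → ℚ) : Set where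
  constructor representing
  field
    agrees : ∀ x → combination G c x ≡ B x
open Represents public

InSpan : ∀ {k} {X : Set} → (Fin k → X → ℚ) → (X → ℚ) → Set
InSpan G B = ∃ λ c → Represents G c B

module Span {k} {X : Set} (G : Fin k → X → ℚ) where

  represents-member : ∀ a → Represents G (δ a) (G a)
  represents-member a = representing λ x → ∑-δˡ a (λ b → G b x)

  represents-cong : ∀ {c B B′} → (∀ x → B x ≡ B′ x) → Represents G c B → Represents G c B′
  represents-cong B≗B′ rep = representing λ x → trans (agrees rep x) (B≗B′ x)

  represents-+ : ∀ {c d B B′} → Represents G c B → Represents G d B′ →
    Represents G (λ a → c a + d a) (λ x → B x + B′ x)
  represents-+ {c} {d} rep rep′ = representing λ x →
    trans (∑-cong (λ a → ℚP.*-distribʳ-+ (G a x) (c a) (d a)))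
          (trans (∑-distrib-+ (λ a → c a * G a x) (λ a → d a * G a x)) (cong₂ _+_ (agrees rep x) (agrees rep′ x)))

  represents-* : ∀ {c B} (r : ℚ) → Represents G c B → Represents G (λ a → r * c a) (λ x → r * B x)
  represents-* {c} r rep = representing λ x →
    trans (∑-cong (λ a → ℚP.*-assoc r (c a) (G a x))) (trans (∑-*ˡ r (λ a → c a * G a x)) (cong (r *_) (agrees rep x)))

  represents-- : ∀ {c d B B′} → Represents G c B → Represents G d B′ →
    Represents G (λ a → c a - d a) (λ x → B x - B′ x)
  represents-- {c} {d} rep rep′ = representing λ x →
    trans (∑-cong (λ a → solve 3 (λ c d g → (c :- d) :* g := c :* g :- d :* g) refl (c a) (d a) (G a x)))
          (trans (∑-distrib-- (λ a → c a * G a x) (λ a → d a * G a x)) (cong₂ _-_ (agrees rep x) (agrees rep′ x)))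

  represents-∑ : ∀ {l} {C : Fin l → Fin k → ℚ} {B : Fin l → X → ℚ} → (∀ t → Represents G (C t) (B t)) →
    Represents G (λ a → ∑ (λ t → C t a)) (λ x → ∑ (λ t → B t x))
  represents-∑ {C = C} {B} rep = representing λ x → begin
    ∑ (λ a → ∑ (λ t → C t a) * G a x)     ≡⟨ ∑-cong (λ a → sym (∑-*ʳ (G a x) (λ t → C t a))) ⟩
    ∑ (λ a → ∑ (λ t → C t a * G a x))     ≡⟨ ∑-comm (λ a t → C t a * G a x) ⟩
    ∑ (λ t → combination G (C t) x)       ≡⟨ ∑-cong (λ t → agrees (rep t) x) ⟩
    ∑ (λ t → B t x)                       ∎

  inSpan-member : ∀ a → InSpan G (G a)
  inSpan-member a = δ a , represents-member a

  inSpan-zero : InSpan G (λ _ → 0ℚ)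
  inSpan-zero = (λ _ → 0ℚ) , representing λ x → ∑-zero (λ a → ℚP.*-zeroˡ (G a x))

  inSpan-cong : ∀ {B B′} → (∀ x → B x ≡ B′ x) → InSpan G B → InSpan G B′
  inSpan-cong B≗B′ (c , rep) = c , represents-cong B≗B′ rep

  inSpan-+ : ∀ {B B′} → InSpan G B → InSpan G B′ → InSpan G (λ x → B x + B′ x)
  inSpan-+ (c , rep) (d , rep′) = _ , represents-+ rep rep′

  inSpan-* : ∀ {B} (r : ℚ) → InSpan G B → InSpan G (λ x → r * B x)
  inSpan-* r (c , rep) = _ , represents-* r rep

  inSpan-∑ : ∀ {l} {B : Fin l → X → ℚ} → (∀ t → InSpan G (B t)) → InSpan G (λ x → ∑ (λ t → B t x))
  inSpan-∑ spanned = _ , represents-∑ (proj₂ ∘ spanned)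

-- Symmetric matrices in block form [[T, v], [vᵀ, x]], T of size n × n

data Slot (n : ℕ) : Set where
  top    : Fin n → Fin n → Slot n
  side   : Fin n → Slot n
  corner : Slot n

Block : ℕ → Set
Block n = Slot n → ℚ

block : ∀ {n} → (Fin n → Fin n → ℚ) → (Fin n → ℚ) → ℚ → Block n
block T v x (top i j) = T i j
block T v x (side i)  = v i
block T v x corner    = x

slot : ∀ {n} → Maybe (Fin n) → Maybe (Fin n) → Slot n
slot (just i) (just j) = top i j
slot (just i) nothing  = side i
slot nothing  (just j) = side j
slot nothing  nothing  = corner

toMat : ∀ {n} → Block n → Mat n
toMat B r s = B (slot (toVert r) (toVert s))

toVert-inject₁ : ∀ {n} (i : Fin n) → toVert (inject₁ i) ≡ just i
toVert-inject₁ {suc n} zero    = refl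
toVert-inject₁ {suc n} (suc i) rewrite toVert-inject₁ i = refl

toVert-fromℕ : ∀ n → toVert (fromℕ n) ≡ nothing
toVert-fromℕ zero    = refl
toVert-fromℕ (suc n) rewrite toVert-fromℕ n = refl

toVert≡just : ∀ {n} (r : Fin (suc n)) {i} → toVert r ≡ just i → r ≡ inject₁ i
toVert≡just {suc n} zero    refl = refl
toVert≡just {suc n} (suc r) eq with toVert r in eq′
toVert≡just {suc n} (suc r) refl | just i = cong suc (toVert≡just r eq′)

toVert≡nothing : ∀ {n} (r : Fin (suc n)) → toVert r ≡ nothing → r ≡ fromℕ n
toVert≡nothing {zero}  zero    _ = refl
toVert≡nothing {suc n} (suc r) eq with toVert r in eq′
... | nothing = cong suc (toVert≡nothing r eq′)

toMat-top : ∀ {n} (B : Block n) i j → toMat B (inject₁ i) (inject₁ j) ≡ B (top i j)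
toMat-top B i j rewrite toVert-inject₁ i | toVert-inject₁ j = refl

toMat-side : ∀ {n} (B : Block n) i → toMat B (inject₁ i) (fromℕ n) ≡ B (side i)
toMat-side {n} B i rewrite toVert-inject₁ i | toVert-fromℕ n = refl

toMat-corner : ∀ {n} (B : Block n) → toMat B (fromℕ n) (fromℕ n) ≡ B corner
toMat-corner {n} B rewrite toVert-fromℕ n = refl

toMat-injective : ∀ {n} {B B′ : Block n} → (∀ r s → toMat B r s ≡ toMat B′ r s) → ∀ σ → B σ ≡ B′ σ
toMat-injective {B = B} {B′} eq (top i j) = trans (sym (toMat-top B i j)) (trans (eq _ _) (toMat-top B′ i j))
toMat-injective {B = B} {B′} eq (side i)  = trans (sym (toMat-side B i)) (trans (eq _ _) (toMat-side B′ i))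
toMat-injective {B = B} {B′} eq corner    = trans (sym (toMat-corner B)) (trans (eq _ _) (toMat-corner B′))

∑-one′ : ∀ {n} (f : Fin (suc n) → ℚ) → ∑ (λ s → f s * one′ s) ≡ ∑ (f ∘ inject₁)
∑-one′ {n} f = begin
  ∑ (λ s → f s * one′ s)                                        ≡⟨ ∑-last (λ s → f s * one′ s) ⟩
  ∑ (λ j → f (inject₁ j) * one′ (inject₁ j)) + f (fromℕ n) * one′ (fromℕ n)
    ≡⟨ cong₂ _+_ (∑-cong (λ j → trans (cong (f (inject₁ j) *_) (one′-inject₁ j)) (ℚP.*-identityʳ _)))
                 (trans (cong (f (fromℕ n) *_) one′-fromℕ) (ℚP.*-zeroʳ (f (fromℕ n)))) ⟩
  ∑ (f ∘ inject₁) + 0ℚ                                          ≡⟨ ℚP.+-identityʳ _ ⟩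
  ∑ (f ∘ inject₁)                                               ∎
  where
  one′-inject₁ : ∀ j → one′ (inject₁ j) ≡ 1ℚ
  one′-inject₁ j rewrite toVert-inject₁ j = refl
  one′-fromℕ : one′ (fromℕ n) ≡ 0ℚ
  one′-fromℕ rewrite toVert-fromℕ n = refl

BlockIn𝓛 : ∀ {n} → Block n → Set
BlockIn𝓛 B = (∀ i j → B (top i j) ≡ B (top j i))
            × (∀ i → ∑ (λ j → B (top i j)) ≡ 0ℚ)
            × ∑ (B ∘ side) ≡ 0ℚ

BlockIn𝓛⇒In𝓛 : ∀ {n} {B : Block n} → BlockIn𝓛 B → In𝓛 (toMat B)
BlockIn𝓛⇒In𝓛 {B = B} (symmetric , rows , side-sum) = (λ r s → symmetric′ (toVert r) (toVert s)) , λ r →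
  trans (∑-one′ (toMat B r))
        (trans (∑-cong (λ j → cong (λ q → B (slot (toVert r) q)) (toVert-inject₁ j))) (row (toVert r)))
  where
  symmetric′ : ∀ p q → B (slot p q) ≡ B (slot q p)
  symmetric′ (just i) (just j) = symmetric i j
  symmetric′ (just i) nothing  = refl
  symmetric′ nothing  (just j) = refl
  symmetric′ nothing  nothing  = refl
  row : ∀ p → ∑ (λ j → B (slot p (just j))) ≡ 0ℚ
  row (just i) = rows i
  row nothing  = side-sum

blockOf : ∀ {n} → Mat n → Block n
blockOf {n} A = block (λ i j → A (inject₁ i) (inject₁ j)) (λ i → A (inject₁ i) (fromℕ n)) (A (fromℕ n) (fromℕ n))

module _ {n} {A : Mat n} (A∈𝓛 : In𝓛 A) where
  private
    symmetric : ∀ r s → A r s ≡ A s r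
    symmetric = proj₁ A∈𝓛
    rows : ∀ r → ∑ (λ s → A r s * one′ s) ≡ 0ℚ
    rows = proj₂ A∈𝓛

  toMat-blockOf : ∀ r s → toMat (blockOf A) r s ≡ A r s
  toMat-blockOf r s with toVert r in eq-r | toVert s in eq-s
  ... | just i  | just j  = sym (cong₂ A (toVert≡just r eq-r) (toVert≡just s eq-s))
  ... | just i  | nothing = sym (cong₂ A (toVert≡just r eq-r) (toVert≡nothing s eq-s))
  ... | nothing | just j  = trans (symmetric _ _) (sym (cong₂ A (toVert≡nothing r eq-r) (toVert≡just s eq-s)))
  ... | nothing | nothing = sym (cong₂ A (toVert≡nothing r eq-r) (toVert≡nothing s eq-s))

  In𝓛⇒BlockIn𝓛 : BlockIn𝓛 (blockOf A)
  In𝓛⇒BlockIn𝓛 = (λ i j → symmetric _ _) , (λ i → row-sum (inject₁ i)) ,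
                  trans (∑-cong {n} (λ i → symmetric (inject₁ i) (fromℕ n))) (row-sum (fromℕ n))
    where
    row-sum : ∀ r → ∑ (λ j → A r (inject₁ j)) ≡ 0ℚ
    row-sum r = trans (sym (∑-one′ (A r))) (rows r)

data Joins {n} (e : Edge n) (i j : Fin n) : Set where
  forward  : src e ≡ i → tgt e ≡ j → Joins e i j
  backward : src e ≡ j → tgt e ≡ i → Joins e i j

joins? : ∀ {n} (e : Edge n) i j → Dec (Joins e i j)
joins? e i j = map′ from to ((src e ≟ᶠ i ×-dec tgt e ≟ᶠ j) ⊎-dec (src e ≟ᶠ j ×-dec tgt e ≟ᶠ i))
  where
  from : (src e ≡ i × tgt e ≡ j) ⊎ (src e ≡ j × tgt e ≡ i) → Joins e i j
  from (inj₁ (s≡i , t≡j)) = forward s≡i t≡j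
  from (inj₂ (s≡j , t≡i)) = backward s≡j t≡i
  to : Joins e i j → (src e ≡ i × tgt e ≡ j) ⊎ (src e ≡ j × tgt e ≡ i)
  to (forward s≡i t≡j)  = inj₁ (s≡i , t≡j)
  to (backward s≡j t≡i) = inj₂ (s≡j , t≡i)

joins≡does : ∀ {n} (e : Edge n) i j → joins e i j ≡ does (joins? e i j)
joins≡does e i j
  rewrite isYes≗does (src e ≟ᶠ i) | isYes≗does (tgt e ≟ᶠ j)
        | isYes≗does (src e ≟ᶠ j) | isYes≗does (tgt e ≟ᶠ i) = refl

joins⇒Joins : ∀ {n} {e : Edge n} {i j} → joins e i j ≡ true → Joins e i j
joins⇒Joins {e = e} {i} {j} h = witness (joins? e i j) (trans (sym (joins≡does e i j)) h)
  where
  witness : ∀ {P : Set} (p? : Dec P) → does p? ≡ true → P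
  witness (yes p) _  = p
  witness (no _)  ()

Joins⇒joins : ∀ {n} {e : Edge n} {i j} → Joins e i j → joins e i j ≡ true
Joins⇒joins {e = e} {i} {j} p = trans (joins≡does e i j) (dec-true (joins? e i j) p)

Joins-self : ∀ {n} (e : Edge n) → Joins e (src e) (tgt e)
Joins-self e = forward refl refl

Joins-unique : ∀ {n} {e : Edge n} {i j k l} → Joins e i j → Joins e k l → (i ≡ k × j ≡ l) ⊎ (i ≡ l × j ≡ k)
Joins-unique (forward refl refl)  (forward refl refl)  = inj₁ (refl , refl)
Joins-unique (forward refl refl)  (backward refl refl) = inj₂ (refl , refl)
Joins-unique (backward refl refl) (forward refl refl)  = inj₂ (refl , refl)
Joins-unique (backward refl refl) (backward refl refl) = inj₁ (refl , refl)

joins-sym : ∀ {n} (e : Edge n) i j → joins e i j ≡ joins e j i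
joins-sym e i j = BoolP.∨-comm (⌊ src e ≟ᶠ i ⌋ ∧ ⌊ tgt e ≟ᶠ j ⌋) (⌊ src e ≟ᶠ j ⌋ ∧ ⌊ tgt e ≟ᶠ i ⌋)

multiplicity-sym : ∀ {n m} (E : Fin m → Edge n) i j → multiplicity E i j ≡ multiplicity E j i
multiplicity-sym E i j = countℕ-cong (λ a → joins-sym (E a) i j)

MultAdj-sym : ∀ {n m} {E : Fin m → Edge n} {i j} → MultAdj E i j → MultAdj E j i
MultAdj-sym {E = E} {i} {j} (i≢j , two≤) = i≢j ∘ sym , subst (2 ≤_) (multiplicity-sym E i j) two≤

MultAdj? : ∀ {n m} (E : Fin m → Edge n) i j → Dec (MultAdj E i j)
MultAdj? E i j = ¬? (i ≟ᶠ j) ×-dec (2 ≤? multiplicity E i j)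

diff : ∀ {n} → Fin n → Fin n → Fin n → ℚ
diff i j k = δ j k - δ i k

incidence : ∀ {n} → Edge n → Fin n → ℚ
incidence e = diff (src e) (tgt e)

label : ∀ {n} → Edge n → ℚ
label e = lab e ℚ./ 1

orientation : ∀ {n} → Edge n → Fin n → Fin n → ℚ
orientation e i j = δ (src e) i * δ (tgt e) j - δ (src e) j * δ (tgt e) i

topBlock : ∀ {n} → (Fin n → Fin n → ℚ) → Block n
topBlock T = block T (λ _ → 0ℚ) 0ℚ

sideBlock : ∀ {n} → (Fin n → ℚ) → Block n
sideBlock v = block (λ _ _ → 0ℚ) v 0ℚ

outerBlock : ∀ {n} → Fin n → Fin n → Block n
outerBlock i j = topBlock (λ r s → diff i j r * diff i j s)

diff-self : ∀ {n} (i k : Fin n) → diff i i k ≡ 0ℚ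
diff-self i k = ℚP.+-inverseʳ (δ i k)

diff-trans : ∀ {n} (i j l k : Fin n) → diff i j k + diff j l k ≡ diff i l k
diff-trans i j l k = solve 3 (λ a b c → (b :- a) :+ (c :- b) := c :- a) refl (δ i k) (δ j k) (δ l k)

∑-diff : ∀ {n} (i j : Fin n) → ∑ (diff i j) ≡ 0ℚ
∑-diff i j = trans (∑-distrib-- (δ j) (δ i)) (cong₂ _-_ (∑-δ j) (∑-δ i))

∑-*-diff : ∀ {n} (f : Fin n → ℚ) (i j : Fin n) → ∑ (λ k → f k * diff i j k) ≡ f j - f i
∑-*-diff f i j = begin
  ∑ (λ k → f k * (δ j k - δ i k))
    ≡⟨ ∑-cong (λ k → solve 3 (λ x a b → x :* (a :- b) := a :* x :- b :* x) refl (f k) (δ j k) (δ i k)) ⟩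
  ∑ (λ k → δ j k * f k - δ i k * f k)
    ≡⟨ ∑-distrib-- (λ k → δ j k * f k) (λ k → δ i k * f k) ⟩
  ∑ (λ k → δ j k * f k) - ∑ (λ k → δ i k * f k)
    ≡⟨ cong₂ _-_ (∑-δˡ j f) (∑-δˡ i f) ⟩
  f j - f i ∎

diff*diff : ∀ {n} {i j : Fin n} → i ≢ j → diff i j i * diff i j j ≡ - 1ℚ
diff*diff {i = i} {j} i≢j rewrite δ-refl i | δ-refl j | δ-≢ i≢j | δ-≢ (i≢j ∘ sym) = refl

orientation-off : ∀ {n} {e : Edge n} {i j} → ¬ Joins e i j → orientation e i j ≡ 0ℚ
orientation-off {e = e} ¬joins = cong₂ _-_
  (δ*δ-off {a = src e} {tgt e} (λ (s≡i , t≡j) → ¬joins (forward s≡i t≡j)))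
  (δ*δ-off {a = src e} {tgt e} (λ (s≡j , t≡i) → ¬joins (backward s≡j t≡i)))

incidence*incidence-off : ∀ {n} {e : Edge n} {i j} → i ≢ j → ¬ Joins e i j → incidence e i * incidence e j ≡ 0ℚ
incidence*incidence-off {e = e} {i} {j} i≢j ¬joins = begin
  (δ t i - δ s i) * (δ t j - δ s j)
    ≡⟨ solve 4 (λ ti si tj sj → (ti :- si) :* (tj :- sj) := ti :* tj :- ti :* sj :- si :* tj :+ si :* sj)
             refl (δ t i) (δ s i) (δ t j) (δ s j) ⟩
  δ t i * δ t j - δ t i * δ s j - δ s i * δ t j + δ s i * δ s j
    ≡⟨ cong₂ (λ x y → x - y - δ s i * δ t j + δ s i * δ s j)
             (δ*δ-off {a = t} {t} (i≢j ∘ same)) (δ*δ-off {a = t} {s} (λ (t≡i , s≡j) → ¬joins (backward s≡j t≡i))) ⟩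
  0ℚ - 0ℚ - δ s i * δ t j + δ s i * δ s j
    ≡⟨ cong₂ (λ x y → 0ℚ - 0ℚ - x + y)
             (δ*δ-off {a = s} {t} (λ (s≡i , t≡j) → ¬joins (forward s≡i t≡j))) (δ*δ-off {a = s} {s} (i≢j ∘ same)) ⟩
  0ℚ ∎
  where
  s = src e
  t = tgt e
  same : ∀ {a : Fin _} → a ≡ i × a ≡ j → i ≡ j
  same (refl , refl) = refl

orientation-forward : ∀ {n} (e : Edge n) {i j} → i ≢ j → src e ≡ i → tgt e ≡ j → orientation e i j ≡ 1ℚ
orientation-forward e {i} {j} i≢j refl refl rewrite δ-refl i | δ-refl j | δ-≢ i≢j | δ-≢ (i≢j ∘ sym) = refl

orientation-backward : ∀ {n} (e : Edge n) {i j} → i ≢ j → src e ≡ j → tgt e ≡ i → orientation e i j ≡ - 1ℚ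
orientation-backward e {i} {j} i≢j refl refl rewrite δ-refl i | δ-refl j | δ-≢ i≢j | δ-≢ (i≢j ∘ sym) = refl

Joins⇒incidence : ∀ {n} {e : Edge n} {i j} → i ≢ j → Joins e i j →
  ∀ k → incidence e k ≡ orientation e i j * diff i j k
Joins⇒incidence {e = e} i≢j (forward refl refl) k rewrite orientation-forward e i≢j refl refl =
  sym (ℚP.*-identityˡ _)
Joins⇒incidence {e = e} i≢j (backward refl refl) k rewrite orientation-backward e i≢j refl refl =
  solve 2 (λ s t → s :- t := (:- con 1ℚ) :* (t :- s)) refl (δ (tgt e) k) (δ (src e) k)

Joins⇒incidence-outer : ∀ {n} {e : Edge n} {i j} → Joins e i j →
  ∀ r s → incidence e r * incidence e s ≡ diff i j r * diff i j s
Joins⇒incidence-outer (forward refl refl) r s = refl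
Joins⇒incidence-outer {e = e} (backward refl refl) r s =
  solve 4 (λ a b c d → (a :- b) :* (c :- d) := (b :- a) :* (d :- c)) refl
          (δ (tgt e) r) (δ (src e) r) (δ (tgt e) s) (δ (src e) s)

Joins⇒incidence*incidence : ∀ {n} {e : Edge n} {i j} → i ≢ j → Joins e i j → incidence e i * incidence e j ≡ - 1ℚ
Joins⇒incidence*incidence i≢j p = trans (Joins⇒incidence-outer p _ _) (diff*diff i≢j)

orientedLabel : ∀ {n} → Edge n → Fin n → Fin n → ℚ
orientedLabel e i j = label e * orientation e i j

Joins⇒incidence*label : ∀ {n} {e : Edge n} {i j} → i ≢ j → Joins e i j → ∀ k →
  incidence e k * label e ≡ orientedLabel e i j * diff i j k
Joins⇒incidence*label {e = e} {i} {j} i≢j p k = trans (cong (_* label e) (Joins⇒incidence i≢j p k))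
  (solve 3 (λ o d l → (o :* d) :* l := (l :* o) :* d) refl (orientation e i j) (diff i j k) (label e))

edge-≡ : ∀ {n} {e f : Edge n} → src e ≡ src f → tgt e ≡ tgt f → lab e ≡ lab f → e ≡ f
edge-≡ refl refl refl = refl

oriented-labels-differ : ∀ {n m} {E : Fin m → Edge n} → IsSimpleLabelled E → ∀ {a b i j} → a ≢ b → i ≢ j →
  Joins (E a) i j → Joins (E b) i j → orientedLabel (E a) i j ≢ orientedLabel (E b) i j
oriented-labels-differ {E = E} (_ , distinct , not-reversed) {a} {b} {i} {j} a≢b i≢j pa pb eq =
  cases pa pb
  where
  ℓa = label (E a)
  ℓb = label (E b)
  neg : ∀ x → x * - 1ℚ ≡ - x
  neg x = solve 1 (λ x → x :* (:- con 1ℚ) := :- x) refl x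
  labels : ∀ {x y} → orientation (E a) i j ≡ x → orientation (E b) i j ≡ y → ℓa * x ≡ ℓb * y
  labels oa ob = trans (cong (ℓa *_) (sym oa)) (trans eq (cong (ℓb *_) ob))
  cases : Joins (E a) i j → Joins (E b) i j → ⊥
  cases (forward sa ta) (forward sb tb) =
    distinct a b a≢b (edge-≡ (trans sa (sym sb)) (trans ta (sym tb)) (/1-injective (begin
      ℓa        ≡⟨ sym (ℚP.*-identityʳ ℓa) ⟩
      ℓa * 1ℚ   ≡⟨ labels (orientation-forward (E a) i≢j sa ta) (orientation-forward (E b) i≢j sb tb) ⟩
      ℓb * 1ℚ   ≡⟨ ℚP.*-identityʳ ℓb ⟩
      ℓb        ∎)))
  cases (backward sa ta) (backward sb tb) =
    distinct a b a≢b (edge-≡ (trans sa (sym sb)) (trans ta (sym tb)) (/1-injective (ℚP.neg-injective (begin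
      - ℓa        ≡⟨ sym (neg ℓa) ⟩
      ℓa * - 1ℚ   ≡⟨ labels (orientation-backward (E a) i≢j sa ta) (orientation-backward (E b) i≢j sb tb) ⟩
      ℓb * - 1ℚ   ≡⟨ neg ℓb ⟩
      - ℓb        ∎))))
  cases (forward sa ta) (backward sb tb) =
    not-reversed a b a≢b (trans sa (sym tb) , trans ta (sym sb) , /1-neg (begin
      ℓa          ≡⟨ sym (ℚP.*-identityʳ ℓa) ⟩
      ℓa * 1ℚ     ≡⟨ labels (orientation-forward (E a) i≢j sa ta) (orientation-backward (E b) i≢j sb tb) ⟩
      ℓb * - 1ℚ   ≡⟨ neg ℓb ⟩
      - ℓb        ∎))
  cases (backward sa ta) (forward sb tb) =
    not-reversed b a (a≢b ∘ sym) (trans sb (sym ta) , trans tb (sym sa) , /1-neg (begin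
      ℓb          ≡⟨ sym (ℚP.*-identityʳ ℓb) ⟩
      ℓb * 1ℚ     ≡⟨ sym (labels (orientation-backward (E a) i≢j sa ta) (orientation-forward (E b) i≢j sb tb)) ⟩
      ℓa * - 1ℚ   ≡⟨ neg ℓa ⟩
      - ℓa        ∎))

edgeBlock : ∀ {n} → Edge n → Block n
edgeBlock e = block (λ i j → incidence e i * incidence e j) (λ i → incidence e i * label e) (label e * label e)

generator : ∀ {n m} → (Fin m → Edge n) → Fin (suc m) → Block n
generator E zero    = block (λ _ _ → 0ℚ) (λ _ → 0ℚ) 1ℚ
generator E (suc a) = edgeBlock (E a)

outer-maybe : ∀ {n} (f : Fin n → ℚ) (x : ℚ) p q →
  maybe f x p * maybe f x q ≡ block (λ i j → f i * f j) (λ i → f i * x) (x * x) (slot p q)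
outer-maybe f x (just i) (just j) = refl
outer-maybe f x (just i) nothing  = refl
outer-maybe f x nothing  (just j) = ℚP.*-comm x (f j)
outer-maybe f x nothing  nothing  = refl

iL≡maybe : ∀ {n} (r : Fin (suc n)) → iL r ≡ maybe (λ _ → 0ℚ) 1ℚ (toVert r)
iL≡maybe r with toVert r
... | just _  = refl
... | nothing = refl

iVec≡maybe : ∀ {n} (e : Edge n) r → iVec e r ≡ maybe (incidence e) (label e) (toVert r)
iVec≡maybe e r with toVert r
... | just _  = refl
... | nothing = refl

𝓕≡toMat-generator : ∀ {n m} (E : Fin m → Edge n) a r s → 𝓕 E a r s ≡ toMat (generator E a) r s
𝓕≡toMat-generator E zero r s =
  trans (cong₂ _*_ (iL≡maybe r) (iL≡maybe s)) (outer-maybe (λ _ → 0ℚ) 1ℚ (toVert r) (toVert s))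
𝓕≡toMat-generator E (suc a) r s =
  trans (cong₂ _*_ (iVec≡maybe (E a) r) (iVec≡maybe (E a) s))
        (outer-maybe (incidence (E a)) (label (E a)) (toVert r) (toVert s))

lincomb≡toMat-combination : ∀ {n m} (E : Fin m → Edge n) c r s →
  lincomb (𝓕 E) c r s ≡ toMat (combination (generator E) c) r s
lincomb≡toMat-combination E c r s = ∑-cong (λ a → cong (c a *_) (𝓕≡toMat-generator E a r s))

LinearlyIndependent-𝓕⇔ : ∀ {n m} (E : Fin m → Edge n) →
  LinearlyIndependent (𝓕 E) ⇔ (∀ c → Represents (generator E) c (λ _ → 0ℚ) → ∀ a → c a ≡ 0ℚ)
LinearlyIndependent-𝓕⇔ E = mk⇔
  (λ independent c represents-0 → independent c λ r s →
     trans (lincomb≡toMat-combination E c r s) (agrees represents-0 (slot (toVert r) (toVert s))))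
  (λ independent c lincomb≡0 → independent c (representing
     (toMat-injective (λ r s → trans (sym (lincomb≡toMat-combination E c r s)) (lincomb≡0 r s)))))

Spans𝓛-𝓕⇔ : ∀ {n m} (E : Fin m → Edge n) →
  Spans𝓛 (𝓕 E) ⇔ (∀ B → BlockIn𝓛 B → InSpan (generator E) B)
Spans𝓛-𝓕⇔ E = mk⇔ to from
  where
  to : Spans𝓛 (𝓕 E) → ∀ B → BlockIn𝓛 B → InSpan (generator E) B
  to spans B B∈𝓛 with spans (toMat B) (BlockIn𝓛⇒In𝓛 {B = B} B∈𝓛)
  ... | c , lincomb≡B = c , representing (toMat-injective λ r s →
    trans (sym (lincomb≡toMat-combination E c r s)) (lincomb≡B r s))
  from : (∀ B → BlockIn𝓛 B → InSpan (generator E) B) → Spans𝓛 (𝓕 E)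
  from spans A A∈𝓛 with spans (blockOf A) (In𝓛⇒BlockIn𝓛 A∈𝓛)
  ... | c , represents = c , λ r s →
    trans (lincomb≡toMat-combination E c r s)
          (trans (agrees represents (slot (toVert r) (toVert s))) (toMat-blockOf A∈𝓛 r s))

gram : ∀ {n m} → (Fin m → Edge n) → (Fin m → ℚ) → Fin n → Fin n → ℚ
gram E d i j = ∑ (λ e → d e * (incidence (E e) i * incidence (E e) j))

flow : ∀ {n m} → (Fin m → Edge n) → (Fin m → ℚ) → Fin n → Fin n → ℚ
flow E d i j = ∑ (λ e → d e * orientedLabel (E e) i j)

module _ {n m} (E : Fin m → Edge n) (c : Fin (suc m) → ℚ) where

  combination-top : ∀ i j → combination (generator E) c (top i j) ≡ gram E (c ∘ suc) i j
  combination-top i j = trans (cong (_+ gram E (c ∘ suc) i j) (ℚP.*-zeroʳ (c zero))) (ℚP.+-identityˡ _)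

  combination-side : ∀ k →
    combination (generator E) c (side k) ≡ ∑ (λ e → c (suc e) * (incidence (E e) k * label (E e)))
  combination-side k = trans (cong (_+ rest) (ℚP.*-zeroʳ (c zero))) (ℚP.+-identityˡ rest)
    where rest = ∑ (λ e → c (suc e) * (incidence (E e) k * label (E e)))

  combination-corner : combination (generator E) c corner ≡ c zero + ∑ (λ e → c (suc e) * (label (E e) * label (E e)))
  combination-corner = cong (_+ ∑ (λ e → c (suc e) * (label (E e) * label (E e)))) (ℚP.*-identityʳ (c zero))

flow-antisym : ∀ {n m} (E : Fin m → Edge n) d i j → flow E d i j ≡ - flow E d j i
flow-antisym E d i j = trans (∑-cong λ e → solve 6
  (λ c l a b x y → c :* (l :* (a :* b :- x :* y)) := :- (c :* (l :* (x :* y :- a :* b)))) refl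
  (d e) (label (E e)) (δ (src (E e)) i) (δ (tgt (E e)) j) (δ (src (E e)) j) (δ (tgt (E e)) i))
  (∑-neg (λ e → d e * orientedLabel (E e) j i))

∑-orientation : ∀ {n} (e : Edge n) k → ∑ (λ j → orientation e j k) ≡ incidence e k
∑-orientation e k = begin
  ∑ (λ j → δ s j * δ t k - δ s k * δ t j)         ≡⟨ ∑-distrib-- (λ j → δ s j * δ t k) (λ j → δ s k * δ t j) ⟩
  ∑ (λ j → δ s j * δ t k) - ∑ (λ j → δ s k * δ t j)
    ≡⟨ cong₂ _-_ (trans (∑-*ʳ (δ t k) (δ s)) (cong (_* δ t k) (∑-δ s)))
                 (trans (∑-*ˡ (δ s k) (δ t)) (cong (δ s k *_) (∑-δ t))) ⟩
  1ℚ * δ t k - δ s k * 1ℚ                          ≡⟨ cong₂ _-_ (ℚP.*-identityˡ (δ t k)) (ℚP.*-identityʳ (δ s k)) ⟩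
  δ t k - δ s k                                    ∎
  where
  s = src e
  t = tgt e

flow-divergence : ∀ {n m} (E : Fin m → Edge n) d k →
  ∑ (λ j → flow E d j k) ≡ ∑ (λ e → d e * (incidence (E e) k * label (E e)))
flow-divergence E d k = begin
  ∑ (λ j → ∑ (λ e → d e * (ℓ e * orientation (E e) j k)))     ≡⟨ ∑-comm (λ j e → d e * (ℓ e * orientation (E e) j k)) ⟩
  ∑ (λ e → ∑ (λ j → d e * (ℓ e * orientation (E e) j k)))     ≡⟨ ∑-cong (λ e → pull e) ⟩
  ∑ (λ e → d e * (incidence (E e) k * ℓ e))                  ∎
  where
  ℓ = label ∘ E
  pull : ∀ e → ∑ (λ j → d e * (ℓ e * orientation (E e) j k)) ≡ d e * (incidence (E e) k * ℓ e)
  pull e = begin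
    ∑ (λ j → d e * (ℓ e * orientation (E e) j k))   ≡⟨ ∑-*ˡ (d e) (λ j → ℓ e * orientation (E e) j k) ⟩
    d e * ∑ (λ j → ℓ e * orientation (E e) j k)     ≡⟨ cong (d e *_) (∑-*ˡ (ℓ e) (λ j → orientation (E e) j k)) ⟩
    d e * (ℓ e * ∑ (λ j → orientation (E e) j k))   ≡⟨ cong (λ x → d e * (ℓ e * x)) (∑-orientation (E e) k) ⟩
    d e * (ℓ e * incidence (E e) k)                 ≡⟨ cong (d e *_) (ℚP.*-comm (ℓ e) _) ⟩
    d e * (incidence (E e) k * ℓ e)                 ∎

module VanishingGram {n m} (E : Fin m → Edge n) (d : Fin m → ℚ) (gram≡0 : ∀ i j → gram E d i j ≡ 0ℚ) where

  private
    gram-term-off : ∀ {g i j} → i ≢ j → ¬ Joins (E g) i j → d g * (incidence (E g) i * incidence (E g) j) ≡ 0ℚ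
    gram-term-off {g} i≢j ¬joins = trans (cong (d g *_) (incidence*incidence-off i≢j ¬joins)) (ℚP.*-zeroʳ (d g))

    flow-term-off : ∀ {g i j} → ¬ Joins (E g) i j → d g * orientedLabel (E g) i j ≡ 0ℚ
    flow-term-off {g} ¬joins = begin
      d g * (label (E g) * orientation (E g) _ _)   ≡⟨ cong (λ o → d g * (label (E g) * o)) (orientation-off ¬joins) ⟩
      d g * (label (E g) * 0ℚ)                       ≡⟨ solve 2 (λ x l → x :* (l :* con 0ℚ) := con 0ℚ) refl (d g) (label (E g)) ⟩
      0ℚ                                             ∎

    gram-term-on : ∀ {g i j} → i ≢ j → Joins (E g) i j → d g * (incidence (E g) i * incidence (E g) j) ≡ - d g
    gram-term-on {g} i≢j jg =
      trans (cong (d g *_) (Joins⇒incidence*incidence i≢j jg)) (solve 1 (λ x → x :* (:- con 1ℚ) := :- x) refl (d g))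

  lone-edge-vanishes : ∀ {e i j} → i ≢ j → Joins (E e) i j → multiplicity E i j ≤ 1 → d e ≡ 0ℚ
  lone-edge-vanishes {e} {i} {j} i≢j je mult≤1 = ℚP.neg-injective (begin
    - d e                                                ≡⟨ sym (gram-term-on i≢j je) ⟩
    d e * (incidence (E e) i * incidence (E e) j)        ≡⟨ sym (∑-single e λ g g≢e → gram-term-off i≢j (g≢e ∘ unique)) ⟩
    gram E d i j                                         ≡⟨ gram≡0 i j ⟩
    0ℚ                                                   ∎)
    where
    unique : ∀ {g} → Joins (E g) i j → g ≡ e
    unique jg = countℕ≤1-unique (λ a → joins (E a) i j) mult≤1 (Joins⇒joins je) (Joins⇒joins jg)

  flow-support : ∀ i j → flow E d i j ≢ 0ℚ → MultAdj E i j
  flow-support i j flow≢0 with i ≟ᶠ j | 2 ≤? multiplicity E i j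
  ... | yes refl | _        = ⊥-elim (flow≢0 (x≡-x⇒x≡0 (flow-antisym E d i i)))
  ... | no i≢j   | yes 2≤μ = i≢j , 2≤μ
  ... | no i≢j   | no 2≰μ  = ⊥-elim (flow≢0 (∑-zero term≡0))
    where
    term≡0 : ∀ g → d g * orientedLabel (E g) i j ≡ 0ℚ
    term≡0 g with joins? (E g) i j
    ... | yes jg = trans (cong (_* orientedLabel (E g) i j) (lone-edge-vanishes i≢j jg (ℕP.≤-pred (ℕP.≰⇒> 2≰μ))))
                         (ℚP.*-zeroˡ (orientedLabel (E g) i j))
    ... | no ¬jg = flow-term-off ¬jg

  flow-on-parallel-edges : ∀ {e f i j} → e ≢ f → i ≢ j → Joins (E e) i j → Joins (E f) i j → multiplicity E i j ≤ 2 →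
    flow E d i j ≡ d e * (orientedLabel (E e) i j - orientedLabel (E f) i j)
  flow-on-parallel-edges {e} {f} {i} {j} e≢f i≢j je jf mult≤2 = begin
    flow E d i j                             ≡⟨ ∑-pair e f e≢f (λ g g≢e g≢f → flow-term-off (other g≢e g≢f)) ⟩
    d e * αₑ + d f * α_f                     ≡⟨ cong (λ x → d e * αₑ + x * α_f) d-f≡-d-e ⟩
    d e * αₑ + - d e * α_f                   ≡⟨ solve 3 (λ x a b → x :* a :+ (:- x) :* b := x :* (a :- b)) refl (d e) αₑ α_f ⟩
    d e * (αₑ - α_f)                         ∎
    where
    αₑ  = orientedLabel (E e) i j
    α_f = orientedLabel (E f) i j
    other : ∀ {g} → g ≢ e → g ≢ f → ¬ Joins (E g) i j
    other g≢e g≢f jg with countℕ≤2-unique (λ a → joins (E a) i j) mult≤2 e≢f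
                                 (Joins⇒joins je) (Joins⇒joins jf) (Joins⇒joins jg)
    ... | inj₁ g≡e = g≢e g≡e
    ... | inj₂ g≡f = g≢f g≡f
    d-f≡-d-e : d f ≡ - d e
    d-f≡-d-e = ℚP.neg-injective (inverseʳ-unique (- d e) (- d f) (begin
      - d e + - d f
        ≡⟨ sym (cong₂ _+_ (gram-term-on i≢j je) (gram-term-on i≢j jf)) ⟩
      d e * (incidence (E e) i * incidence (E e) j) + d f * (incidence (E f) i * incidence (E f) j)
        ≡⟨ sym (∑-pair e f e≢f (λ g g≢e g≢f → gram-term-off i≢j (other g≢e g≢f))) ⟩
      gram E d i j
        ≡⟨ gram≡0 i j ⟩
      0ℚ ∎))

another-edge : ∀ {n m} {E : Fin m → Edge n} {i j} → 2 ≤ multiplicity E i j → ∀ e → ∃ λ f → f ≢ e × Joins (E f) i j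
another-edge {E = E} {i} {j} 2≤μ e with countℕ-two-witnesses (λ a → joins (E a) i j) 2≤μ
... | a , b , a≢b , ja , jb with a ≟ᶠ e
...   | yes refl = b , a≢b ∘ sym , joins⇒Joins jb
...   | no a≢e   = a , a≢e , joins⇒Joins ja

-- (i), sufficiency

forest⇒independent : ∀ {n m} (E : Fin m → Edge n) → IsSimpleLabelled E → NoSelfloop E → MultAtMostTwo E →
  IsForest (MultAdj E) → ∀ c → Represents (generator E) c (λ _ → 0ℚ) → ∀ a → c a ≡ 0ℚ
forest⇒independent E simple no-loop μ≤2 forest c represents-0 = coefficient≡0
  where
  d = c ∘ suc
  open VanishingGram E d (λ i j → trans (sym (combination-top E c i j)) (agrees represents-0 (top i j)))

  flow≡0 : ∀ i j → flow E d i j ≡ 0ℚ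
  flow≡0 = circulation-on-forest forest (flow E d) (flow-antisym E d)
    (λ k → trans (flow-divergence E d k) (trans (sym (combination-side E c k)) (agrees represents-0 (side k))))
    flow-support

  edge-coefficient≡0 : ∀ e → d e ≡ 0ℚ
  edge-coefficient≡0 e with multiplicity E (src (E e)) (tgt (E e)) ≤? 1
  ... | yes μ≤1 = lone-edge-vanishes (no-loop e) (Joins-self (E e)) μ≤1
  ... | no μ≰1 with another-edge (ℕP.≰⇒> μ≰1) e
  ...   | f , f≢e , jf = p*q≡0⇒p≡0 (p≢q⇒p-q≢0 (oriented-labels-differ simple e≢f s≢t je jf))
                           (trans (sym (flow-on-parallel-edges e≢f s≢t je jf (μ≤2 _ _ s≢t))) (flow≡0 _ _))
    where
    s≢t = no-loop e
    e≢f = f≢e ∘ sym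
    je = Joins-self (E e)

  coefficient≡0 : ∀ a → c a ≡ 0ℚ
  coefficient≡0 (suc e) = edge-coefficient≡0 e
  coefficient≡0 zero    = begin
    c zero                                                  ≡⟨ sym (ℚP.+-identityʳ (c zero)) ⟩
    c zero + 0ℚ                                             ≡⟨ cong (c zero +_) (sym (∑-zero edge-terms≡0)) ⟩
    c zero + ∑ (λ e → d e * ℓ² e)                          ≡⟨ sym (combination-corner E c) ⟩
    combination (generator E) c corner                      ≡⟨ agrees represents-0 corner ⟩
    0ℚ                                                      ∎
    where
    ℓ² : Fin _ → ℚ
    ℓ² e = label (E e) * label (E e)
    edge-terms≡0 : ∀ e → d e * ℓ² e ≡ 0ℚ
    edge-terms≡0 e = trans (cong (_* ℓ² e) (edge-coefficient≡0 e)) (ℚP.*-zeroˡ (ℓ² e))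

-- (ii), necessity

module _ {n m} (E : Fin m → Edge n) (spans : ∀ B → BlockIn𝓛 B → InSpan (generator E) B) where

  edge-between : ∀ {i j} → i ≢ j → ∃ λ a → Joins (E a) i j
  edge-between {i} {j} i≢j with FinP.any? (λ a → joins? (E a) i j)
  ... | yes found = found
  ... | no none   = ⊥-elim (ℚP.1≢0 (ℚP.neg-injective (begin
    - 1ℚ                                        ≡⟨ sym (diff*diff i≢j) ⟩
    diff i j i * diff i j j                     ≡⟨ sym (agrees represents (top i j)) ⟩
    combination (generator E) c (top i j)       ≡⟨ combination-top E c i j ⟩
    gram E (c ∘ suc) i j                        ≡⟨ ∑-zero no-term ⟩
    0ℚ                                          ∎)))
    where
    outer∈𝓛 : BlockIn𝓛 (outerBlock i j)
    outer∈𝓛 = (λ r s → ℚP.*-comm (diff i j r) (diff i j s)) ,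
              (λ r → trans (∑-*ˡ (diff i j r) (diff i j))
                           (trans (cong (diff i j r *_) (∑-diff i j)) (ℚP.*-zeroʳ (diff i j r)))) ,
              ∑-zero {n} (λ _ → refl)
    c = proj₁ (spans (outerBlock i j) outer∈𝓛)
    represents = proj₂ (spans (outerBlock i j) outer∈𝓛)
    no-term : ∀ e → c (suc e) * (incidence (E e) i * incidence (E e) j) ≡ 0ℚ
    no-term e = trans (cong (c (suc e) *_) (incidence*incidence-off i≢j (none ∘ (e ,_)))) (ℚP.*-zeroʳ (c (suc e)))

  spans⇒complete : SiIsComplete E
  spans⇒complete i j = proj₁ , λ i≢j → i≢j , let a , ja = edge-between i≢j in a , Joins⇒joins ja

  open Reachability (MultAdj E) (MultAdj? E)

  -- The component S of i₀ has net inflow −1, but no multiplicity edge leaves S and simple edges carry no flow.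
  spans⇒spanning : IsSpanning (MultAdj E)
  spans⇒spanning i₀ j₀ with reach? i₀ j₀
  ... | yes r  = r
  ... | no ¬r = ⊥-elim (ℚP.1≢0 (ℚP.neg-injective (begin
    - 1ℚ                                                  ≡⟨ cong₂ _-_ (sym (reached-no ¬r)) (sym (reached-yes {i₀} here)) ⟩
    reached i₀ j₀ - reached i₀ i₀                         ≡⟨ sym (∑-*-diff (reached i₀) i₀ j₀) ⟩
    ∑ (λ k → reached i₀ k * diff i₀ j₀ k)                 ≡⟨ ∑-cong (λ k → cong (reached i₀ k *_) (sym (divergence k))) ⟩
    ∑ (λ k → reached i₀ k * ∑ (λ j → flow E d j k))       ≡⟨ flux (reached i₀) (flow E d) (flow-antisym E d) ⟩
    ∑ (λ k → ∑ (λ j → (reached i₀ k * (1ℚ - reached i₀ j)) * flow E d j k))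
      ≡⟨ ∑-zero (λ k → ∑-zero (λ j → crossing-zero (no-flow-out j k))) ⟩
    0ℚ                                                    ∎)))
    where
    target∈𝓛 : BlockIn𝓛 (sideBlock (diff i₀ j₀))
    target∈𝓛 = (λ _ _ → refl) , (λ _ → ∑-zero {n} (λ _ → refl)) , ∑-diff i₀ j₀
    c = proj₁ (spans (sideBlock (diff i₀ j₀)) target∈𝓛)
    represents = proj₂ (spans (sideBlock (diff i₀ j₀)) target∈𝓛)
    d = c ∘ suc
    open VanishingGram E d (λ i j → trans (sym (combination-top E c i j)) (agrees represents (top i j)))
    divergence : ∀ k → ∑ (λ j → flow E d j k) ≡ diff i₀ j₀ k
    divergence k = trans (flow-divergence E d k) (trans (sym (combination-side E c k)) (agrees represents (side k)))
    no-flow-out : ∀ j k → Reach (MultAdj E) i₀ k → ¬ Reach (MultAdj E) i₀ j → flow E d j k ≡ 0ℚ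
    no-flow-out j k rk ¬rj = decidable-stable (flow E d j k ℚP.≟ 0ℚ) λ flow≢0 →
      ¬rj (reach-snoc rk (MultAdj-sym {E = E} (flow-support j k flow≢0)))

record ParallelEdges {n m} (E : Fin m → Edge n) (u v : Fin n) : Set where
  field
    first second : Fin m
    distinct     : first ≢ second
    first-joins  : Joins (E first) u v
    second-joins : Joins (E second) u v

MultAdj⇒ParallelEdges : ∀ {n m} (E : Fin m → Edge n) {u v} → MultAdj E u v → ParallelEdges E u v
MultAdj⇒ParallelEdges E {u} {v} (_ , 2≤μ) with countℕ-two-witnesses (λ a → joins (E a) u v) 2≤μ
... | a , b , a≢b , ja , jb = record
  { first = a ; second = b ; distinct = a≢b ; first-joins = joins⇒Joins ja ; second-joins = joins⇒Joins jb }

module PairCombination {n m} {E : Fin m → Edge n} (simple : IsSimpleLabelled E)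
                       {u v} (u≢v : u ≢ v) (P : ParallelEdges E u v) where
  open ParallelEdges P
  open Span (generator E)

  private
    g = first
    h = second
    ℓg = label (E g)
    ℓh = label (E h)
    gap : ℚ
    gap = orientedLabel (E g) u v - orientedLabel (E h) u v
    gap≢0 : gap ≢ 0ℚ
    gap≢0 = p≢q⇒p-q≢0 (oriented-labels-differ simple distinct u≢v first-joins second-joins)
    instance
      gap-nonZero : ℚ.NonZero gap
      gap-nonZero = ℚ.≢-nonZero gap≢0

  opaque
    κ : ℚ
    κ = 1/ gap

    κ*gap≡1 : κ * gap ≡ 1ℚ
    κ*gap≡1 = ℚP.*-inverseˡ gap

  κ≢0 : κ ≢ 0ℚ
  κ≢0 κ≡0 = ℚP.1≢0 (trans (sym κ*gap≡1) (trans (cong (_* gap) κ≡0) (ℚP.*-zeroˡ gap)))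

  private
    K : ℚ
    K = κ * (ℓg * ℓg - ℓh * ℓh)

  coefficients : Fin (suc m) → ℚ
  coefficients a = κ * (δ (suc g) a - δ (suc h) a) - K * δ zero a

  represents-side-diff : Represents (generator E) coefficients (sideBlock (diff u v))
  represents-side-diff = represents-cong reshape
    (represents-- (represents-* κ (represents-- (represents-member (suc g)) (represents-member (suc h))))
                  (represents-* K (represents-member zero)))
    where
    reshape : ∀ σ → κ * (generator E (suc g) σ - generator E (suc h) σ) - K * generator E zero σ
                  ≡ sideBlock (diff u v) σ
    reshape (top r s) = begin
      κ * (incidence (E g) r * incidence (E g) s - incidence (E h) r * incidence (E h) s) - K * 0ℚ
        ≡⟨ cong₂ (λ x y → κ * (x - y) - K * 0ℚ)
                 (Joins⇒incidence-outer first-joins r s) (Joins⇒incidence-outer second-joins r s) ⟩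
      κ * (diff u v r * diff u v s - diff u v r * diff u v s) - K * 0ℚ
        ≡⟨ solve 3 (λ k K x → k :* (x :- x) :- K :* con 0ℚ := con 0ℚ) refl κ K (diff u v r * diff u v s) ⟩
      0ℚ ∎
    reshape (side r) = begin
      κ * (incidence (E g) r * ℓg - incidence (E h) r * ℓh) - K * 0ℚ
        ≡⟨ cong₂ (λ x y → κ * (x - y) - K * 0ℚ)
                 (Joins⇒incidence*label u≢v first-joins r) (Joins⇒incidence*label u≢v second-joins r) ⟩
      κ * (αg * diff u v r - αh * diff u v r) - K * 0ℚ
        ≡⟨ solve 5 (λ k a b D K → k :* (a :* D :- b :* D) :- K :* con 0ℚ := (k :* (a :- b)) :* D) refl
                   κ αg αh (diff u v r) K ⟩
      (κ * gap) * diff u v r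
        ≡⟨ cong (_* diff u v r) κ*gap≡1 ⟩
      1ℚ * diff u v r
        ≡⟨ ℚP.*-identityˡ (diff u v r) ⟩
      diff u v r ∎
      where
      αg = orientedLabel (E g) u v
      αh = orientedLabel (E h) u v
    reshape corner =
      solve 3 (λ k a b → k :* (a :* a :- b :* b) :- (k :* (a :* a :- b :* b)) :* con 1ℚ := con 0ℚ) refl κ ℓg ℓh

  coefficient-first : coefficients (suc g) ≡ κ
  coefficient-first = begin
    κ * (δ (suc g) (suc g) - δ (suc h) (suc g)) - K * δ zero (suc g)
      ≡⟨ cong₂ (λ x y → κ * (x - y) - K * δ zero (suc g))
               (δ-refl (suc g)) (δ-≢ (distinct ∘ sym ∘ FinP.suc-injective)) ⟩
    κ * (1ℚ - 0ℚ) - K * 0ℚ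
      ≡⟨ solve 2 (λ k K → k :* (con 1ℚ :- con 0ℚ) :- K :* con 0ℚ := k) refl κ K ⟩
    κ ∎

  coefficient-other : ∀ {e} → e ≢ g → e ≢ h → coefficients (suc e) ≡ 0ℚ
  coefficient-other {e} e≢g e≢h = begin
    κ * (δ (suc g) (suc e) - δ (suc h) (suc e)) - K * δ zero (suc e)
      ≡⟨ cong₂ (λ x y → κ * (x - y) - K * δ zero (suc e))
               (δ-≢ (e≢g ∘ sym ∘ FinP.suc-injective)) (δ-≢ (e≢h ∘ sym ∘ FinP.suc-injective)) ⟩
    κ * (0ℚ - 0ℚ) - K * 0ℚ
      ≡⟨ solve 2 (λ k K → k :* (con 0ℚ :- con 0ℚ) :- K :* con 0ℚ := con 0ℚ) refl κ K ⟩
    0ℚ ∎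

-- (i), necessity

module _ {n m} (E : Fin m → Edge n) (simple : IsSimpleLabelled E)
         (independent : ∀ c → Represents (generator E) c (λ _ → 0ℚ) → ∀ a → c a ≡ 0ℚ) where
  open Span (generator E)

  independent⇒no-selfloop : NoSelfloop E
  independent⇒no-selfloop a s≡t = ℚP.1≢0 (trans (sym coefficient) (independent _ dependence (suc a)))
    where
    ℓ² = label (E a) * label (E a)
    incidence≡0 : ∀ k → incidence (E a) k ≡ 0ℚ
    incidence≡0 k = trans (cong (λ s → diff s (tgt (E a)) k) s≡t) (diff-self (tgt (E a)) k)
    dependence : Represents (generator E) (λ b → δ (suc a) b - ℓ² * δ zero b) (λ _ → 0ℚ)
    dependence = represents-cong vanish
      (represents-- (represents-member (suc a)) (represents-* ℓ² (represents-member zero)))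
      where
      vanish : ∀ σ → generator E (suc a) σ - ℓ² * generator E zero σ ≡ 0ℚ
      first-factor≡0 : ∀ i y → incidence (E a) i * y - ℓ² * 0ℚ ≡ 0ℚ
      first-factor≡0 i y = trans (cong (λ x → x * y - ℓ² * 0ℚ) (incidence≡0 i))
                                 (solve 2 (λ y l → con 0ℚ :* y :- l :* con 0ℚ := con 0ℚ) refl y ℓ²)
      vanish (top i j) = first-factor≡0 i (incidence (E a) j)
      vanish (side i)  = first-factor≡0 i (label (E a))
      vanish corner = solve 1 (λ l → l :- l :* con 1ℚ := con 0ℚ) refl ℓ²
    coefficient : δ (suc a) (suc a) - ℓ² * δ zero (suc a) ≡ 1ℚ
    coefficient =
      trans (cong (λ x → x - ℓ² * 0ℚ) (δ-refl (suc a))) (solve 1 (λ l → con 1ℚ :- l :* con 0ℚ := con 1ℚ) refl ℓ²)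

  -- The pairs (a, b) and (b, c) give two combinations for e_j − e_i, differing at a.
  no-three-parallel-edges : ∀ {i j a b c} → i ≢ j → a ≢ b → a ≢ c → b ≢ c →
    Joins (E a) i j → Joins (E b) i j → Joins (E c) i j → ⊥
  no-three-parallel-edges {i} {j} {a} {b} {c} i≢j a≢b a≢c b≢c ja jb jc = Pab.κ≢0 (begin
    Pab.κ
      ≡⟨ sym (ℚP.+-identityʳ Pab.κ) ⟩
    Pab.κ - 0ℚ
      ≡⟨ sym (cong₂ _-_ Pab.coefficient-first (Pbc.coefficient-other a≢b a≢c)) ⟩
    Pab.coefficients (suc a) - Pbc.coefficients (suc a)
      ≡⟨ independent _ dependence (suc a) ⟩
    0ℚ ∎)
    where
    ab bc : ParallelEdges E i j
    ab = record { first = a ; second = b ; distinct = a≢b ; first-joins = ja ; second-joins = jb }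
    bc = record { first = b ; second = c ; distinct = b≢c ; first-joins = jb ; second-joins = jc }
    module Pab = PairCombination simple i≢j ab
    module Pbc = PairCombination simple i≢j bc
    dependence : Represents (generator E) (λ e → Pab.coefficients e - Pbc.coefficients e) (λ _ → 0ℚ)
    dependence = represents-cong (λ σ → ℚP.+-inverseʳ (sideBlock (diff i j) σ))
                                 (represents-- Pab.represents-side-diff Pbc.represents-side-diff)

  independent⇒multiplicity≤2 : MultAtMostTwo E
  independent⇒multiplicity≤2 i j i≢j with multiplicity E i j ≤? 2
  ... | yes μ≤2 = μ≤2
  ... | no μ≰2 =
    let a , b , c , a≢b , a≢c , b≢c , ja , jb , jc =
          countℕ-three-witnesses (λ a → joins (E a) i j) (ℕP.≰⇒> μ≰2)
    in ⊥-elim (no-three-parallel-edges i≢j a≢b a≢c b≢c (joins⇒Joins ja) (joins⇒Joins jb) (joins⇒Joins jc))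

  -- Around a cycle the vectors e_{p(t+1)} − e_{p(t)} sum to 0, and the first edge of the closing pair
  -- joins no other pair of the cycle.
  independent⇒forest : IsForest (MultAdj E)
  independent⇒forest (k , p , injective , adjacent , closing) = Last.κ≢0 (begin
    Last.κ
      ≡⟨ sym (ℚP.+-identityˡ Last.κ) ⟩
    0ℚ + Last.κ
      ≡⟨ sym (cong₂ _+_ (∑-zero steps-off) Last.coefficient-first) ⟩
    ∑ (λ t → Step.coefficients t (suc gL)) + Last.coefficients (suc gL)
      ≡⟨ independent _ dependence (suc gL) ⟩
    0ℚ ∎)
    where
    L = fromℕ (suc (suc k))
    step-pair : ∀ t → ParallelEdges E (p (inject₁ t)) (p (suc t))
    step-pair t = MultAdj⇒ParallelEdges E (adjacent t)
    closing-pair : ParallelEdges E (p L) (p zero)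
    closing-pair = MultAdj⇒ParallelEdges E closing
    module Step (t : Fin (suc (suc k))) = PairCombination simple (proj₁ (adjacent t)) (step-pair t)
    module Last = PairCombination simple (proj₁ closing) closing-pair
    open ParallelEdges closing-pair using () renaming (first to gL; first-joins to gL-joins)

    off-closing : ∀ t {e} → Joins (E e) (p (inject₁ t)) (p (suc t)) → e ≢ gL
    off-closing t je refl with Joins-unique je gL-joins
    ... | inj₁ (same , _) = FinP.fromℕ≢inject₁ (sym (injective same))
    ... | inj₂ (p-t≡p-0 , p-t+1≡p-L) with FinP.inject₁-injective {i = t} {zero} (injective p-t≡p-0)
    ...   | refl with injective p-t+1≡p-L
    ...     | ()

    steps-off : ∀ t → Step.coefficients t (suc gL) ≡ 0ℚ
    steps-off t = Step.coefficient-other t (off-closing t first-joins ∘ sym) (off-closing t second-joins ∘ sym)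
      where open ParallelEdges (step-pair t)

    dependence : Represents (generator E) (λ a → ∑ (λ t → Step.coefficients t a) + Last.coefficients a) (λ _ → 0ℚ)
    dependence = represents-cong vanish
      (represents-+ (represents-∑ Step.represents-side-diff) Last.represents-side-diff)
      where
      vanish : ∀ σ → ∑ (λ t → sideBlock (diff (p (inject₁ t)) (p (suc t))) σ)
                       + sideBlock (diff (p L) (p zero)) σ ≡ 0ℚ
      vanish (top i j) = cong (_+ 0ℚ) (∑-zero {suc (suc k)} (λ _ → refl))
      vanish corner    = cong (_+ 0ℚ) (∑-zero {suc (suc k)} (λ _ → refl))
      vanish (side r)  = begin
        ∑ (λ t → δ (p (suc t)) r - δ (p (inject₁ t)) r) + diff (p L) (p zero) r
          ≡⟨ cong (_+ diff (p L) (p zero) r) (∑-telescope (λ t → δ (p t) r)) ⟩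
        (δ (p L) r - δ (p zero) r) + (δ (p zero) r - δ (p L) r)
          ≡⟨ solve 2 (λ a b → (a :- b) :+ (b :- a) := con 0ℚ) refl (δ (p L) r) (δ (p zero) r) ⟩
        0ℚ ∎

-- (ii), sufficiency

module LaplacianDecomposition {n} (T : Fin n → Fin n → ℚ) (symmetric : ∀ i j → T i j ≡ T j i)
                              (rows : ∀ i → ∑ (T i) ≡ 0ℚ) where

  weight : Fin n → Fin n → ℚ
  weight i j = - ℚ.½ * T i j

  private
    w = weight

    weight-rows : ∀ i → ∑ (w i) ≡ 0ℚ
    weight-rows i = trans (∑-*ˡ (- ℚ.½) (T i)) (trans (cong (- ℚ.½ *_) (rows i)) (ℚP.*-zeroʳ (- ℚ.½)))

    weight-columns : ∀ j → ∑ (λ i → w i j) ≡ 0ℚ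
    weight-columns j = trans (∑-cong (λ i → cong (- ℚ.½ *_) (symmetric i j))) (weight-rows j)

    row-term : ∀ i r s → ∑ (λ j → w i j * (diff i j r * diff i j s)) ≡ w i r * δ r s - w i r * δ i s - δ i r * w i s
    row-term i r s = begin
      ∑ (λ j → w i j * (diff i j r * diff i j s))
        ≡⟨ ∑-cong (λ j → solve 5 (λ W a b c d → W :* ((a :- b) :* (c :- d)) :=
              (W :* c) :* a :- (W :* d) :* a :- (b :* W) :* c :+ (b :* d) :* W) refl
              (w i j) (δ j r) (δ i r) (δ j s) (δ i s)) ⟩
      ∑ (λ j → A j - B j - C j + (δ i r * δ i s) * w i j)
        ≡⟨ ∑-distrib-+ (λ j → A j - B j - C j) (λ j → (δ i r * δ i s) * w i j) ⟩
      ∑ (λ j → A j - B j - C j) + ∑ (λ j → (δ i r * δ i s) * w i j)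
        ≡⟨ cong₂ _+_ (∑-distrib-- (λ j → A j - B j) C)
                     (trans (∑-*ˡ (δ i r * δ i s) (w i))
                            (trans (cong (δ i r * δ i s *_) (weight-rows i)) (ℚP.*-zeroʳ (δ i r * δ i s)))) ⟩
      ∑ (λ j → A j - B j) - ∑ C + 0ℚ
        ≡⟨ cong (λ z → z - ∑ C + 0ℚ) (∑-distrib-- A B) ⟩
      ∑ A - ∑ B - ∑ C + 0ℚ
        ≡⟨ cong₂ (λ a b → a - b - ∑ C + 0ℚ) (∑-δʳ r (λ j → w i j * δ j s)) (∑-δʳ r (λ j → w i j * δ i s)) ⟩
      w i r * δ r s - w i r * δ i s - ∑ C + 0ℚ
        ≡⟨ cong (λ z → w i r * δ r s - w i r * δ i s - z + 0ℚ) (∑-δʳ s (λ j → δ i r * w i j)) ⟩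
      w i r * δ r s - w i r * δ i s - δ i r * w i s + 0ℚ
        ≡⟨ ℚP.+-identityʳ _ ⟩
      w i r * δ r s - w i r * δ i s - δ i r * w i s ∎
      where
      A B C : Fin n → ℚ
      A j = (w i j * δ j s) * δ j r
      B j = (w i j * δ i s) * δ j r
      C j = (δ i r * w i j) * δ j s

  decomposition : ∀ r s → ∑ (λ i → ∑ (λ j → weight i j * (diff i j r * diff i j s))) ≡ T r s
  decomposition r s = begin
    ∑ (λ i → ∑ (λ j → w i j * (diff i j r * diff i j s)))
      ≡⟨ ∑-cong (λ i → row-term i r s) ⟩
    ∑ (λ i → w i r * δ r s - w i r * δ i s - δ i r * w i s)
      ≡⟨ ∑-distrib-- (λ i → w i r * δ r s - w i r * δ i s) (λ i → δ i r * w i s) ⟩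
    ∑ (λ i → w i r * δ r s - w i r * δ i s) - ∑ (λ i → δ i r * w i s)
      ≡⟨ cong₂ _-_ (∑-distrib-- (λ i → w i r * δ r s) (λ i → w i r * δ i s))
                   (trans (∑-cong (λ i → ℚP.*-comm (δ i r) (w i s))) (∑-δʳ r (λ i → w i s))) ⟩
    ∑ (λ i → w i r * δ r s) - ∑ (λ i → w i r * δ i s) - w r s
      ≡⟨ cong₂ (λ a b → a - b - w r s)
               (trans (∑-*ʳ (δ r s) (λ i → w i r)) (trans (cong (_* δ r s) (weight-columns r)) (ℚP.*-zeroˡ (δ r s))))
               (∑-δʳ s (λ i → w i r)) ⟩
    0ℚ - w s r - w r s
      ≡⟨ cong (λ z → 0ℚ - - ℚ.½ * z - w r s) (symmetric s r) ⟩
    0ℚ - - ℚ.½ * T r s - - ℚ.½ * T r s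
      ≡⟨ solve 1 (λ t → con 0ℚ :- (:- con ℚ.½) :* t :- (:- con ℚ.½) :* t := t) refl (T r s) ⟩
    T r s ∎

-- A vector v with ∑ v = 0 is ∑ₜ vₜ (e_t − e_0).
sideBlock-in-span : ∀ {n k} (G : Fin k → Block n) → (∀ u v → InSpan G (sideBlock (diff u v))) →
  ∀ v → ∑ v ≡ 0ℚ → InSpan G (sideBlock v)
sideBlock-in-span {zero} G _ v _ = inSpan-cong (λ { (top () _) ; (side ()) ; corner → refl }) inSpan-zero
  where open Span G
sideBlock-in-span {suc n} G diffs v ∑v≡0 =
  inSpan-cong reshape (inSpan-∑ (λ t → inSpan-* (v t) (diffs zero t)))
  where
  open Span G
  reshape : ∀ σ → ∑ (λ t → v t * sideBlock (diff zero t) σ) ≡ sideBlock v σ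
  reshape (top i j) = ∑-zero (λ t → ℚP.*-zeroʳ (v t))
  reshape corner    = ∑-zero (λ t → ℚP.*-zeroʳ (v t))
  reshape (side r)  = begin
    ∑ (λ t → v t * (δ t r - δ zero r))
      ≡⟨ ∑-cong (λ t → ℚP.*-distribˡ-+ (v t) (δ t r) (- δ zero r)) ⟩
    ∑ (λ t → v t * δ t r + v t * - δ zero r)
      ≡⟨ ∑-distrib-+ (λ t → v t * δ t r) (λ t → v t * - δ zero r) ⟩
    ∑ (λ t → v t * δ t r) + ∑ (λ t → v t * - δ zero r)
      ≡⟨ cong₂ _+_ (∑-δʳ r v) (∑-*ʳ (- δ zero r) v) ⟩
    v r + ∑ v * - δ zero r
      ≡⟨ cong (λ z → v r + z * - δ zero r) ∑v≡0 ⟩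
    v r + 0ℚ * - δ zero r
      ≡⟨ solve 2 (λ x d → x :+ con 0ℚ :* d := x) refl (v r) (- δ zero r) ⟩
    v r ∎

module _ {n m} (E : Fin m → Edge n) (simple : IsSimpleLabelled E) where
  open Span (generator E)

  sideBlock-diff-in-span : ∀ {u v} → Reach (MultAdj E) u v → InSpan (generator E) (sideBlock (diff u v))
  sideBlock-diff-in-span {u} here =
    inSpan-cong (λ { (top _ _) → refl ; (side k) → sym (diff-self u k) ; corner → refl }) inSpan-zero
  sideBlock-diff-in-span {u} {v} (step {j = w} uw path) = inSpan-cong reshape
    (inSpan-+ (_ , PairCombination.represents-side-diff simple (proj₁ uw) (MultAdj⇒ParallelEdges E uw))
              (sideBlock-diff-in-span path))
    where
    reshape : ∀ σ → sideBlock (diff u w) σ + sideBlock (diff w v) σ ≡ sideBlock (diff u v) σ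
    reshape (top _ _) = refl
    reshape (side k)  = diff-trans u w v k
    reshape corner    = refl

  module _ (complete : SiIsComplete E) (spanning : IsSpanning (MultAdj E)) where

    -- F_a − z(a) [[0, d], [dᵀ, 0]] − z(a)² F_{e_L} for an edge a between i and j, with incidence vector d.
    outerBlock-in-span : ∀ i j → InSpan (generator E) (outerBlock i j)
    outerBlock-in-span i j with i ≟ᶠ j
    ... | yes refl = inSpan-cong outer-self inSpan-zero
      where
      outer-self : ∀ σ → 0ℚ ≡ outerBlock i i σ
      outer-self (top r s) = sym (trans (cong (_* diff i i s) (diff-self i r)) (ℚP.*-zeroˡ (diff i i s)))
      outer-self (side _)  = refl
      outer-self corner    = refl
    ... | no i≢j with proj₂ (proj₂ (complete i j) i≢j)
    ...   | a , ja = inSpan-cong reshape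
      (inSpan-+ (inSpan-+ (inSpan-member (suc a))
                          (inSpan-* (- ℓ) (sideBlock-diff-in-span (spanning (src (E a)) (tgt (E a))))))
                (inSpan-* (- (ℓ * ℓ)) (inSpan-member zero)))
      where
      ℓ = label (E a)
      reshape : ∀ σ → generator E (suc a) σ + - ℓ * sideBlock (incidence (E a)) σ + - (ℓ * ℓ) * generator E zero σ
                    ≡ outerBlock i j σ
      reshape (top r s) = trans (solve 2 (λ l x → x :+ (:- l) :* con 0ℚ :+ (:- (l :* l)) :* con 0ℚ := x) refl
                                       ℓ (incidence (E a) r * incidence (E a) s))
                                (Joins⇒incidence-outer {e = E a} (joins⇒Joins ja) r s)
      reshape (side r)  =
        solve 2 (λ l x → x :* l :+ (:- l) :* x :+ (:- (l :* l)) :* con 0ℚ := con 0ℚ) refl ℓ (incidence (E a) r)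
      reshape corner    =
        solve 1 (λ l → l :* l :+ (:- l) :* con 0ℚ :+ (:- (l :* l)) :* con 1ℚ := con 0ℚ) refl ℓ

    topBlock-in-span : ∀ T → (∀ i j → T i j ≡ T j i) → (∀ i → ∑ (T i) ≡ 0ℚ) →
      InSpan (generator E) (topBlock T)
    topBlock-in-span T symmetric rows = inSpan-cong reshape
      (inSpan-∑ (λ i → inSpan-∑ (λ j → inSpan-* (weight i j) (outerBlock-in-span i j))))
      where
      open LaplacianDecomposition T symmetric rows
      reshape : ∀ σ → ∑ (λ i → ∑ (λ j → weight i j * outerBlock i j σ)) ≡ topBlock T σ
      reshape (top r s) = decomposition r s
      reshape (side _)  = ∑-zero (λ i → ∑-zero (λ j → ℚP.*-zeroʳ (weight i j)))
      reshape corner    = ∑-zero (λ i → ∑-zero (λ j → ℚP.*-zeroʳ (weight i j)))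

    spanning⇒spans : ∀ B → BlockIn𝓛 B → InSpan (generator E) B
    spanning⇒spans B (symmetric , rows , side-sum) = inSpan-cong reshape
      (inSpan-+ (inSpan-+ (topBlock-in-span (λ i j → B (top i j)) symmetric rows) side-in-span)
                (inSpan-* (B corner) (inSpan-member zero)))
      where
      side-in-span : InSpan (generator E) (sideBlock (B ∘ side))
      side-in-span = sideBlock-in-span (generator E) (λ u v → sideBlock-diff-in-span (spanning u v)) (B ∘ side) side-sum
      reshape : ∀ σ → topBlock (λ i j → B (top i j)) σ + sideBlock (B ∘ side) σ
                        + B corner * generator E zero σ ≡ B σ
      reshape (top i j) = solve 2 (λ x c → x :+ con 0ℚ :+ c :* con 0ℚ := x) refl (B (top i j)) (B corner)
      reshape (side i)  = solve 2 (λ x c → con 0ℚ :+ x :+ c :* con 0ℚ := x) refl (B (side i)) (B corner)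
      reshape corner    = solve 1 (λ c → con 0ℚ :+ con 0ℚ :+ c :* con 1ℚ := c) refl (B corner)

lemma6p4 : ∀ (n m : ℕ) (E : Fin m → Edge n) → IsSimpleLabelled E →
    (LinearlyIndependent (𝓕 E) ⇔ (NoSelfloop E × MultAtMostTwo E × IsForest (MultAdj E)))
    × (Spans𝓛 (𝓕 E) ⇔ (SiIsComplete E × IsSpanning (MultAdj E)))
lemma6p4 n m E simple =
  mk⇔ (λ li → let independent = LI.to li in
         independent⇒no-selfloop E simple independent ,
         independent⇒multiplicity≤2 E simple independent ,
         independent⇒forest E simple independent)
      (λ (no-loop , μ≤2 , forest) → LI.from (forest⇒independent E simple no-loop μ≤2 forest)) ,
  mk⇔ (λ spans → let block-spans = SP.to spans in spans⇒complete E block-spans , spans⇒spanning E block-spans)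
      (λ (complete , spanning) → SP.from (spanning⇒spans E simple complete spanning))
  where
  module LI = Equivalence (LinearlyIndependent-𝓕⇔ E)
  module SP = Equivalence (Spans𝓛-𝓕⇔ E)
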